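{- For every set of permutations $\Pi$ and every $m\in\mathbb{N}_0$ there exist a polynomial $P$ and an integer $n_0$ such that $M_n^m(\Pi)=P(n)$ for every $n\ge n_0$.
   Context: $S_n$ is the set of permutations of $[n]$ written as sequences $\pi_1\cdots\pi_n$. A permutation avoids a set $\Pi$ of patterns if it contains no subsequence order-isomorphic to some $\sigma\in\Pi$. $\mathrm{maj}(\pi)=\sum_{i:\pi_i>\pi_{i+1}}i$. $M_n^m(\Pi)$ is the number of $\Pi$-avoiding permutations in $S_n$ with major index $m$. -}

module Defs where

open import Data.Nat using (ℕ; zero; suc; _+_; _*_; _<ᵇ_; _≡ᵇ_)
open import Data.Bool using (Bool; true; false; _∧_; _∨_; not; if_then_else_)
open import Data.List using (List; []; _∷_; map; concatMap; length; upTo; _++_)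
open import Data.Bool.ListAction using (any)
open import Data.Integer using (+_)
open import Data.Rational as ℚ using (ℚ)
open import Relation.Binary.PropositionalEquality using (_≡_)

-- A permutation of [n] = {1,…,n} is represented by its one-line notation
-- π₁⋯πₙ as a list of naturals (with values in 1..n, pairwise distinct).

words : ℕ → ℕ → List (List ℕ)
words n zero    = [] ∷ []
words n (suc k) = concatMap (λ w → map (λ a → suc a ∷ w) (upTo n)) (words n k)

filterᵇ : {A : Set} → (A → Bool) → List A → List A
filterᵇ p []       = []
filterᵇ p (x ∷ xs) = if p x then x ∷ filterᵇ p xs else filterᵇ p xs

elemᵇ : ℕ → List ℕ → Bool
elemᵇ a xs = any (λ x → x ≡ᵇ a) xs

distinctᵇ : List ℕ → Bool
distinctᵇ []       = true
distinctᵇ (x ∷ xs) = not (elemᵇ x xs) ∧ distinctᵇ xs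

S : ℕ → List (List ℕ)
S n = filterᵇ distinctᵇ (words n n)

subseqs : List ℕ → List (List ℕ)
subseqs []       = [] ∷ []
subseqs (x ∷ xs) = let r = subseqs xs in map (x ∷_) r ++ r

-- standardization: replace each entry by its rank (1-based) among the entries.
-- For a word of distinct letters, st w is the unique permutation
-- order-isomorphic to w.
rank : ℕ → List ℕ → ℕ
rank a xs = suc (length (filterᵇ (λ x → x <ᵇ a) xs))

st : List ℕ → List ℕ
st w = map (λ a → rank a w) w

-- A set of permutations (patterns) Π is given by its characteristic
-- function on one-line notations.
PatternSet : Set
PatternSet = List ℕ → Bool

containsᵇ : PatternSet → List ℕ → Bool
containsᵇ Π π = any (λ w → Π (st w)) (subseqs π)

avoidsᵇ : PatternSet → List ℕ → Bool
avoidsᵇ Π π = not (containsᵇ Π π)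

majFrom : ℕ → List ℕ → ℕ
majFrom i []           = 0
majFrom i (x ∷ [])     = 0
majFrom i (x ∷ y ∷ zs) = (if y <ᵇ x then i else 0) + majFrom (suc i) (y ∷ zs)

maj : List ℕ → ℕ
maj = majFrom 1

M : ℕ → ℕ → PatternSet → ℕ
M n m Π = length (filterᵇ (λ π → avoidsᵇ Π π ∧ (maj π ≡ᵇ m)) (S n))

-- Polynomials with rational coefficients, as coefficient lists
-- [a₀, a₁, …, a_d] meaning a₀ + a₁ x + ⋯ + a_d x^d.
Poly : Set
Poly = List ℚ

eval : Poly → ℚ → ℚ
eval []       x = ℚ.0ℚ
eval (a ∷ as) x = a ℚ.+ x ℚ.* eval as x

ℕ→ℚ : ℕ → ℚ
ℕ→ℚ n = + n ℚ./ 1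

-- All descents of a permutation with major index m lie among its first m positions, so such a
-- π ∈ Sₙ (n > m) is a block A of m + 1 entries followed by the remaining values in increasing
-- order.  It is recorded by the standardisation σ ∈ S_{m+1} of A together with the m + 2 gaps
-- between consecutive members of 0 < sorted A < n + 1, a weak composition g of n − m − 1.
-- Hence Mₙᵐ(Π) is a sum over σ of the number of compositions g for which the assembled
-- permutation avoids Π and has major index m.  Enlarging one gap embeds the assembled
-- permutation order-preservingly into the new one without changing its major index, so each
-- of these sets of compositions is downward closed.  Classically, an antitone sequence of
-- downward closed sets of k-tuples stabilises; by induction on k this makes the number of
-- compositions of N in a downward closed set eventually a finite combination of binomials
-- C(N, j), hence eventually a polynomial in N.

module Submission where

open import Defs
open import Level using (0ℓ)
open import Axiom.ExcludedMiddle using (ExcludedMiddle)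
open import Data.Nat using (ℕ; _≥_)
open import Data.Product using (Σ; _×_)
open import Relation.Binary.PropositionalEquality using (_≡_)

module ListFacts where

  open import Data.Bool.Base using (Bool; true; false; T; not)
  open import Data.Bool.Properties using (T-∧; T-≡)
  open import Data.Empty using (⊥-elim)
  open import Data.Nat.Base using (suc; _+_; _≤_; _<_; z≤n; s≤s; _≡ᵇ_)
  open import Data.Nat.Properties using (+-suc; m≤n⇒m≤1+n; ≡ᵇ⇒≡; ≡⇒≡ᵇ)
  open import Data.Nat.ListAction using (sum)
  open import Data.List.Base using (List; []; _∷_; _++_; map; concatMap; length)
  open import Data.List.Properties using (length-++)
  open import Data.List.Membership.Propositional using (_∈_; _∉_; find; lose)
  open import Data.List.Membership.Propositional.Properties using (∈-++⁺ʳ; ∈-concatMap⁻)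
  open import Data.List.Relation.Unary.Any using (here; there)
  open import Data.List.Relation.Unary.Any.Properties using (any⁺; any⁻)
  open import Data.List.Relation.Unary.All as All using (All; []; _∷_)
  open import Data.List.Relation.Unary.AllPairs using (AllPairs; []; _∷_)
  open import Data.List.Relation.Unary.Unique.Propositional using (Unique)
  import Data.List.Relation.Unary.Unique.Propositional.Properties as Unique
  open import Data.List.Relation.Binary.Sublist.Propositional using (_⊆_; []; _∷_; _∷ʳ_)
  open import Data.List.Membership.Propositional.Properties.WithK using (unique∧set⇒bag)
  open import Data.List.Relation.Binary.BagAndSetEquality using (∼bag⇒↭)
  open import Data.List.Relation.Binary.Permutation.Propositional.Properties using (↭-length)
  open import Data.Product using (_×_; _,_)
  open import Function using (_∘_; _⇔_; Equivalence)
  open import Relation.Nullary using (¬_; contradiction)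
  open import Relation.Binary.PropositionalEquality using (_≡_; refl; sym; trans; cong; subst)

  private variable
    A B : Set
    P : A → Set
    R : A → A → Set
    x : A
    xs ys : List A

  All-resp-⊆ : xs ⊆ ys → All P ys → All P xs
  All-resp-⊆ []           []         = []
  All-resp-⊆ (y ∷ʳ sub)   (_ ∷ pys)  = All-resp-⊆ sub pys
  All-resp-⊆ (refl ∷ sub) (py ∷ pys) = py ∷ All-resp-⊆ sub pys

  AllPairs-resp-⊆ : xs ⊆ ys → AllPairs R ys → AllPairs R xs
  AllPairs-resp-⊆ []           []           = []
  AllPairs-resp-⊆ (y ∷ʳ sub)   (_ ∷ rys)    = AllPairs-resp-⊆ sub rys
  AllPairs-resp-⊆ (refl ∷ sub) (ry ∷ rys)   = All-resp-⊆ sub ry ∷ AllPairs-resp-⊆ sub rys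

  T-not⇒¬T : ∀ {b} → T (not b) → ¬ T b
  T-not⇒¬T {true} ()

  ¬T⇒T-not : ∀ {b} → ¬ T b → T (not b)
  ¬T⇒T-not {true}  ¬b = ¬b _
  ¬T⇒T-not {false} _  = _

  T-injective : ∀ {a b} → T a ⇔ T b → a ≡ b
  T-injective {true}  {b}     a⇔b = sym (Equivalence.to T-≡ (Equivalence.to a⇔b _))
  T-injective {false} {true}  a⇔b = ⊥-elim (Equivalence.from a⇔b _)
  T-injective {false} {false} _   = refl

  filterᵇ-⊆ : ∀ (p : A → Bool) xs → filterᵇ p xs ⊆ xs
  filterᵇ-⊆ p []       = []
  filterᵇ-⊆ p (x ∷ xs) with p x
  ... | true  = refl ∷ filterᵇ-⊆ p xs
  ... | false = x ∷ʳ filterᵇ-⊆ p xs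

  ∈-filterᵇ⁻ : ∀ (p : A → Bool) xs → x ∈ filterᵇ p xs → x ∈ xs × T (p x)
  ∈-filterᵇ⁻ p (y ∷ ys) x∈ with p y in eq
  ∈-filterᵇ⁻ p (y ∷ ys) (here refl) | true = here refl , subst T (sym eq) _
  ∈-filterᵇ⁻ p (y ∷ ys) (there x∈) | true  = let x∈ys , px = ∈-filterᵇ⁻ p ys x∈ in there x∈ys , px
  ∈-filterᵇ⁻ p (y ∷ ys) x∈         | false = let x∈ys , px = ∈-filterᵇ⁻ p ys x∈ in there x∈ys , px

  ∈-filterᵇ⁺ : ∀ (p : A → Bool) xs → x ∈ xs → T (p x) → x ∈ filterᵇ p xs
  ∈-filterᵇ⁺ p (y ∷ ys) (here refl) px with p y
  ... | true = here refl
  ∈-filterᵇ⁺ p (y ∷ ys) (there x∈) px with p y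
  ... | true  = there (∈-filterᵇ⁺ p ys x∈ px)
  ... | false = ∈-filterᵇ⁺ p ys x∈ px

  Unique-filterᵇ : ∀ (p : A → Bool) → Unique xs → Unique (filterᵇ p xs)
  Unique-filterᵇ p = AllPairs-resp-⊆ (filterᵇ-⊆ p _)

  filterᵇ-cong-local : ∀ (p q : A → Bool) xs → (∀ {x} → x ∈ xs → p x ≡ q x) → filterᵇ p xs ≡ filterᵇ q xs
  filterᵇ-cong-local p q []       p≡q = refl
  filterᵇ-cong-local p q (x ∷ xs) p≡q rewrite p≡q (here refl) with q x
  ... | true  = cong (x ∷_) (filterᵇ-cong-local p q xs (p≡q ∘ there))
  ... | false = filterᵇ-cong-local p q xs (p≡q ∘ there)

  filterᵇ-map : ∀ (p : B → Bool) (f : A → B) xs → filterᵇ p (map f xs) ≡ map f (filterᵇ (p ∘ f) xs)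
  filterᵇ-map p f []       = refl
  filterᵇ-map p f (x ∷ xs) with p (f x)
  ... | true  = cong (f x ∷_) (filterᵇ-map p f xs)
  ... | false = filterᵇ-map p f xs

  filterᵇ-++ : ∀ (p : A → Bool) xs ys → filterᵇ p (xs ++ ys) ≡ filterᵇ p xs ++ filterᵇ p ys
  filterᵇ-++ p []       ys = refl
  filterᵇ-++ p (x ∷ xs) ys with p x
  ... | true  = cong (x ∷_) (filterᵇ-++ p xs ys)
  ... | false = filterᵇ-++ p xs ys

  filterᵇ-all : ∀ (p : A → Bool) xs → (∀ {x} → x ∈ xs → T (p x)) → filterᵇ p xs ≡ xs
  filterᵇ-all p []       all = refl
  filterᵇ-all p (x ∷ xs) all with p x | all (here refl)
  ... | true | _ = cong (x ∷_) (filterᵇ-all p xs (all ∘ there))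

  filterᵇ-none : ∀ (p : A → Bool) xs → (∀ {x} → x ∈ xs → ¬ T (p x)) → filterᵇ p xs ≡ []
  filterᵇ-none p []       none = refl
  filterᵇ-none p (x ∷ xs) none with p x | none (here refl)
  ... | true  | ¬px = contradiction _ ¬px
  ... | false | _   = filterᵇ-none p xs (none ∘ there)

  length-filterᵇ-not : ∀ (p : A → Bool) xs →
    length (filterᵇ p xs) + length (filterᵇ (not ∘ p) xs) ≡ length xs
  length-filterᵇ-not p []       = refl
  length-filterᵇ-not p (x ∷ xs) with p x
  ... | true  = cong suc (length-filterᵇ-not p xs)
  ... | false = trans (+-suc _ _) (cong suc (length-filterᵇ-not p xs))

  length-filterᵇ-mono : ∀ (p q : A → Bool) xs → (∀ {x} → x ∈ xs → T (p x) → T (q x)) →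
    length (filterᵇ p xs) ≤ length (filterᵇ q xs)
  length-filterᵇ-mono p q []       p⇒q = z≤n
  length-filterᵇ-mono p q (x ∷ xs) p⇒q with p x | q x | p⇒q (here refl)
  ... | true  | true  | _ = s≤s (length-filterᵇ-mono p q xs (p⇒q ∘ there))
  ... | true  | false | p⇒q₀ = ⊥-elim (p⇒q₀ _)
  ... | false | true  | _ = m≤n⇒m≤1+n (length-filterᵇ-mono p q xs (p⇒q ∘ there))
  ... | false | false | _ = length-filterᵇ-mono p q xs (p⇒q ∘ there)

  length-filterᵇ-mono-< : ∀ (p q : A → Bool) xs → (∀ {x} → x ∈ xs → T (p x) → T (q x)) →
    x ∈ xs → ¬ T (p x) → T (q x) → length (filterᵇ p xs) < length (filterᵇ q xs)
  length-filterᵇ-mono-< p q (y ∷ ys) p⇒q (here refl) ¬py qy with p y | q y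
  ... | true  | _    = contradiction _ ¬py
  ... | false | true = s≤s (length-filterᵇ-mono p q ys (p⇒q ∘ there))
  length-filterᵇ-mono-< p q (y ∷ ys) p⇒q (there x∈) ¬px qx with p y | q y | p⇒q (here refl)
  ... | true  | true  | _ = s≤s (length-filterᵇ-mono-< p q ys (p⇒q ∘ there) x∈ ¬px qx)
  ... | true  | false | p⇒q₀ = ⊥-elim (p⇒q₀ _)
  ... | false | true  | _ = m≤n⇒m≤1+n (length-filterᵇ-mono-< p q ys (p⇒q ∘ there) x∈ ¬px qx)
  ... | false | false | _ = length-filterᵇ-mono-< p q ys (p⇒q ∘ there) x∈ ¬px qx

  length-filterᵇ-concatMap : ∀ (p : B → Bool) (f : A → List B) xs →
    length (filterᵇ p (concatMap f xs)) ≡ sum (map (λ x → length (filterᵇ p (f x))) xs)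
  length-filterᵇ-concatMap p f []       = refl
  length-filterᵇ-concatMap p f (x ∷ xs) = trans
    (cong length (filterᵇ-++ p (f x) (concatMap f xs)))
    (trans (length-++ (filterᵇ p (f x)))
           (cong (length (filterᵇ p (f x)) +_) (length-filterᵇ-concatMap p f xs)))

  elemᵇ⇒∈ : ∀ a xs → T (elemᵇ a xs) → a ∈ xs
  elemᵇ⇒∈ a xs e with b , b∈ , b≡a ← find (any⁻ (_≡ᵇ a) xs e) rewrite ≡ᵇ⇒≡ b a b≡a = b∈

  ∈⇒elemᵇ : ∀ a xs → a ∈ xs → T (elemᵇ a xs)
  ∈⇒elemᵇ a xs a∈ = any⁺ (_≡ᵇ a) (lose a∈ (≡⇒≡ᵇ a a refl))

  ∉⇒All≢ : x ∉ xs → All (λ y → ¬ x ≡ y) xs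
  ∉⇒All≢ {xs = []}     x∉ = []
  ∉⇒All≢ {xs = y ∷ ys} x∉ = (x∉ ∘ here) ∷ ∉⇒All≢ (x∉ ∘ there)

  All≢⇒∉ : All (λ y → ¬ x ≡ y) xs → x ∉ xs
  All≢⇒∉ (x≢y ∷ _)   (here x≡y) = x≢y x≡y
  All≢⇒∉ (_ ∷ x≢ys) (there x∈)  = All≢⇒∉ x≢ys x∈

  distinctᵇ⇒Unique : ∀ xs → T (distinctᵇ xs) → Unique xs
  distinctᵇ⇒Unique []       _ = []
  distinctᵇ⇒Unique (x ∷ xs) d with x∉ , dxs ← Equivalence.to T-∧ d =
    ∉⇒All≢ (T-not⇒¬T x∉ ∘ ∈⇒elemᵇ x xs) ∷ distinctᵇ⇒Unique xs dxs

  Unique⇒distinctᵇ : ∀ xs → Unique xs → T (distinctᵇ xs)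
  Unique⇒distinctᵇ []       []          = _
  Unique⇒distinctᵇ (x ∷ xs) (x≢ ∷ uxs) =
    Equivalence.from T-∧ (¬T⇒T-not (All≢⇒∉ x≢ ∘ elemᵇ⇒∈ x xs) , Unique⇒distinctᵇ xs uxs)

  Unique-map-local : ∀ (f : A → B) xs → Unique xs →
    (∀ {x y} → x ∈ xs → y ∈ xs → f x ≡ f y → x ≡ y) → Unique (map f xs)
  Unique-map-local f []       []          inj = []
  Unique-map-local f (x ∷ xs) (x≢ ∷ uxs) inj =
    map-≢ xs x≢ (λ y∈ → inj (here refl) (there y∈))
      ∷ Unique-map-local f xs uxs (λ a∈ b∈ → inj (there a∈) (there b∈))
    where
    map-≢ : ∀ ys → All (λ y → ¬ x ≡ y) ys → (∀ {y} → y ∈ ys → f x ≡ f y → x ≡ y) →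
            All (λ z → ¬ f x ≡ z) (map f ys)
    map-≢ []       []         _   = []
    map-≢ (y ∷ ys) (x≢y ∷ ps) inj = (x≢y ∘ inj (here refl)) ∷ map-≢ ys ps (inj ∘ there)

  Unique-concatMap : ∀ (f : A → List B) xs → Unique xs → (∀ {x} → x ∈ xs → Unique (f x)) →
    (∀ {x x′ y} → x ∈ xs → x′ ∈ xs → y ∈ f x → y ∈ f x′ → x ≡ x′) → Unique (concatMap f xs)
  Unique-concatMap f []       _           _     _       = []
  Unique-concatMap f (x ∷ xs) (x≢ ∷ uxs) uniqF shared = Unique.++⁺
    (uniqF (here refl))
    (Unique-concatMap f xs uxs (uniqF ∘ there) (λ a∈ b∈ → shared (there a∈) (there b∈)))
    λ (y∈fx , y∈rest) →
      let x′ , x′∈ , y∈fx′ = find (∈-concatMap⁻ f {xs = xs} y∈rest)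
      in All≢⇒∉ x≢ (subst (_∈ xs) (sym (shared (here refl) (there x′∈) y∈fx y∈fx′)) x′∈)

  length-≡-if-same-elements : Unique xs → Unique ys → (∀ {x} → x ∈ xs ⇔ x ∈ ys) →
    length xs ≡ length ys
  length-≡-if-same-elements uxs uys xs≈ys = ↭-length (∼bag⇒↭ (unique∧set⇒bag uxs uys xs≈ys))

  Unique-++-disjoint : Unique (xs ++ ys) → x ∈ xs → ¬ x ∈ ys
  Unique-++-disjoint {xs = x ∷ xs} (x≢ ∷ _) (here refl) x∈ys = All≢⇒∉ x≢ (∈-++⁺ʳ xs x∈ys)
  Unique-++-disjoint {xs = x ∷ xs} (_ ∷ u)  (there x∈)  x∈ys = Unique-++-disjoint u x∈ x∈ys

module Enumerations where

  open ListFacts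
  open import Data.Nat.Base using (ℕ; zero; suc; _+_; _∸_; _≤_; _<_; z≤n; s≤s)
  open import Data.Nat.Properties using (suc-injective; ≤-pred; <⇒≢; m+n∸m≡n; m+[n∸m]≡n; m≤m+n)
  open import Data.Nat.ListAction using (sum)
  open import Data.List.Base using (List; []; _∷_; map; concatMap; length; upTo; applyUpTo)
  open import Data.List.Properties using (length-applyUpTo; ∷-injective)
  open import Data.List.Membership.Propositional using (_∈_; find; lose)
  open import Data.List.Membership.Propositional.Properties
    using (∈-map⁺; ∈-map⁻; ∈-upTo⁺; ∈-upTo⁻; ∈-applyUpTo⁺; ∈-applyUpTo⁻; ∈-concatMap⁺; ∈-concatMap⁻)
  open import Data.List.Relation.Unary.Any using (here)
  open import Data.List.Relation.Unary.All using (All; []; _∷_)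
  open import Data.List.Relation.Unary.AllPairs as AllPairs using (AllPairs; []; _∷_)
  import Data.List.Relation.Unary.AllPairs.Properties as AllPairsₚ
  open import Data.List.Relation.Unary.Unique.Propositional using (Unique)
  import Data.List.Relation.Unary.Unique.Propositional.Properties as Unique
  open import Data.Product using (_×_; _,_; proj₁; proj₂)
  open import Function using (_∘_)
  open import Relation.Binary.PropositionalEquality using (_≡_; refl; sym; trans; cong)

  Increasing : List ℕ → Set
  Increasing = AllPairs _<_

  Increasing⇒Unique : ∀ {xs} → Increasing xs → Unique xs
  Increasing⇒Unique = AllPairs.map <⇒≢

  InRange : ℕ → ℕ → Set
  InRange n v = 0 < v × v ≤ n

  range : ℕ → List ℕ
  range n = applyUpTo suc n

  ∈-range⁻ : ∀ n {v} → v ∈ range n → InRange n v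
  ∈-range⁻ n v∈ with i , i<n , refl ← ∈-applyUpTo⁻ suc v∈ = s≤s z≤n , i<n

  ∈-range⁺ : ∀ n {v} → InRange n v → v ∈ range n
  ∈-range⁺ n {suc v} (_ , v<n) = ∈-applyUpTo⁺ suc v<n

  range-increasing : ∀ n → Increasing (range n)
  range-increasing n = AllPairsₚ.applyUpTo⁺₁ suc n (λ i<j _ → s≤s i<j)

  length-range : ∀ n → length (range n) ≡ n
  length-range = length-applyUpTo suc

  record IsPerm (n : ℕ) (π : List ℕ) : Set where
    field
      length≡ : length π ≡ n
      inRange : All (InRange n) π
      unique  : Unique π

  ∈-words⁻ : ∀ n k {w} → w ∈ words n k → length w ≡ k × All (InRange n) w
  ∈-words⁻ n zero    (here refl) = refl , []
  ∈-words⁻ n (suc k) w∈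
    with w , w∈words , a∷w∈ ← find (∈-concatMap⁻ (λ w → map (λ a → suc a ∷ w) (upTo n)) {xs = words n k} w∈)
    with a , a∈ , refl ← ∈-map⁻ _ a∷w∈
    with len , bounded ← ∈-words⁻ n k w∈words
    = cong suc len , (s≤s z≤n , ∈-upTo⁻ a∈) ∷ bounded

  ∈-words⁺ : ∀ n k {w} → length w ≡ k → All (InRange n) w → w ∈ words n k
  ∈-words⁺ n zero    {[]}        refl []        = here refl
  ∈-words⁺ n (suc k) {suc a ∷ w} len  ((_ , a<n) ∷ bounded) =
    ∈-concatMap⁺ _ (lose (∈-words⁺ n k (suc-injective len) bounded) (∈-map⁺ _ (∈-upTo⁺ a<n)))

  Unique-words : ∀ n k → Unique (words n k)
  Unique-words n zero    = [] ∷ []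
  Unique-words n (suc k) = Unique-concatMap _ (words n k) (Unique-words n k)
    (λ _ → Unique.map⁺ (suc-injective ∘ proj₁ ∘ ∷-injective) (Unique.upTo⁺ n))
    (λ _ _ v∈ v∈′ → tails-agree v∈ v∈′)
    where
    tails-agree : ∀ {w w′ v} → v ∈ map (λ a → suc a ∷ w) (upTo n) → v ∈ map (λ a → suc a ∷ w′) (upTo n) → w ≡ w′
    tails-agree v∈ v∈′ with _ , _ , refl ← ∈-map⁻ _ v∈ | _ , _ , v≡ ← ∈-map⁻ _ v∈′ = proj₂ (∷-injective v≡)

  ∈-S⁻ : ∀ n {π} → π ∈ S n → IsPerm n π
  ∈-S⁻ n π∈ with π∈words , d ← ∈-filterᵇ⁻ distinctᵇ (words n n) π∈ with len , bounded ← ∈-words⁻ n n π∈words =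
    record { length≡ = len ; inRange = bounded ; unique = distinctᵇ⇒Unique _ d }

  ∈-S⁺ : ∀ n {π} → IsPerm n π → π ∈ S n
  ∈-S⁺ n perm = ∈-filterᵇ⁺ distinctᵇ (words n n) (∈-words⁺ n n length≡ inRange) (Unique⇒distinctᵇ _ unique)
    where open IsPerm perm

  Unique-S : ∀ n → Unique (S n)
  Unique-S n = Unique-filterᵇ distinctᵇ (Unique-words n n)

  compositions : ℕ → ℕ → List (List ℕ)
  compositions zero    zero    = [] ∷ []
  compositions zero    (suc N) = []
  compositions (suc k) N       = concatMap (λ x → map (x ∷_) (compositions k (N ∸ x))) (upTo (suc N))

  IsComposition : ℕ → ℕ → List ℕ → Set
  IsComposition k N g = length g ≡ k × sum g ≡ N

  ∈-compositions⁻ : ∀ k N {g} → g ∈ compositions k N → IsComposition k N g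
  ∈-compositions⁻ zero zero (here refl) = refl , refl
  ∈-compositions⁻ (suc k) N g∈
    with x , x∈ , x∷h∈ ← find (∈-concatMap⁻ (λ x → map (x ∷_) (compositions k (N ∸ x))) {xs = upTo (suc N)} g∈)
    with h , h∈ , refl ← ∈-map⁻ _ x∷h∈
    with len , total ← ∈-compositions⁻ k (N ∸ x) h∈
    = cong suc len , trans (cong (x +_) total) (m+[n∸m]≡n (≤-pred (∈-upTo⁻ x∈)))

  ∈-compositions⁺ : ∀ k N {g} → IsComposition k N g → g ∈ compositions k N
  ∈-compositions⁺ zero    zero    {[]}    _            = here refl
  ∈-compositions⁺ (suc k) N       {x ∷ h} (len , refl) = ∈-concatMap⁺ _ (lose (∈-upTo⁺ (s≤s (m≤m+n x (sum h))))
    (∈-map⁺ _ (∈-compositions⁺ k _ (suc-injective len , sym (m+n∸m≡n x (sum h))))))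

  Unique-compositions : ∀ k N → Unique (compositions k N)
  Unique-compositions zero    zero    = [] ∷ []
  Unique-compositions zero    (suc N) = []
  Unique-compositions (suc k) N       = Unique-concatMap _ (upTo (suc N)) (Unique.upTo⁺ (suc N))
    (λ {x} _ → Unique.map⁺ (proj₂ ∘ ∷-injective) (Unique-compositions k (N ∸ x)))
    (λ _ _ v∈ v∈′ → heads-agree v∈ v∈′)
    where
    heads-agree : ∀ {x y v} → v ∈ map (x ∷_) (compositions k (N ∸ x)) →
                  v ∈ map (y ∷_) (compositions k (N ∸ y)) → x ≡ y
    heads-agree v∈ v∈′ with _ , _ , refl ← ∈-map⁻ _ v∈ | _ , _ , v≡ ← ∈-map⁻ _ v∈′ = proj₁ (∷-injective v≡)

module Newton where

  open import Data.Nat.Base as ℕ using (ℕ; zero; suc; _∸_; _≤_)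
  import Data.Nat.Properties as ℕ
  open import Data.Integer.Base as ℤ using (+_)
  import Data.Integer.Properties as ℤ
  open import Data.Rational.Base using (ℚ; mkℚ; 0ℚ; 1ℚ; _+_; _/_)
  import Data.Rational.Properties as ℚ
  open import Data.Rational.Solver using (module +-*-Solver)
  open import Data.Nat.Coprimality using (1-coprimeTo; sym)
  open import Data.Nat.ListAction using (sum)
  open import Data.List.Base using (List; []; _∷_; map; applyUpTo)
  open import Data.List.Membership.Propositional using (_∈_)
  open import Data.List.Relation.Unary.Any using (here; there)
  open import Data.Product using (Σ; _,_)
  open import Function using (_∘_)
  open import Relation.Binary.PropositionalEquality
    using (_≡_; refl; trans; cong; cong₂; module ≡-Reasoning) renaming (sym to ≡-sym)

  ℕ→ℚ≡mkℚ : ∀ n → ℕ→ℚ n ≡ mkℚ (+ n) 0 (sym (1-coprimeTo n))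
  ℕ→ℚ≡mkℚ n = ℚ.normalize-coprime (sym (1-coprimeTo n))

  ℕ→ℚ-+ : ∀ m n → ℕ→ℚ (m ℕ.+ n) ≡ ℕ→ℚ m + ℕ→ℚ n
  ℕ→ℚ-+ m n rewrite ℕ→ℚ≡mkℚ m | ℕ→ℚ≡mkℚ n = cong (_/ 1)
    (≡-sym (trans (cong₂ ℤ._+_ (ℤ.*-identityʳ (+ m)) (ℤ.*-identityʳ (+ n))) (ℤ.pos-+ m n)))

  ℕ→ℚ-suc : ∀ n → ℕ→ℚ (suc n) ≡ ℕ→ℚ n + 1ℚ
  ℕ→ℚ-suc n = trans (cong ℕ→ℚ (ℕ.+-comm 1 n)) (ℕ→ℚ-+ n 1)

  -- newton cs k = Σⱼ cs[j] · C(k, j), computed through Pascal's rule.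
  newton : List ℚ → ℕ → ℚ
  newton []       k       = 0ℚ
  newton (c ∷ cs) zero    = c
  newton (c ∷ cs) (suc k) = newton (c ∷ cs) k + newton cs k

  EventuallyNewton : (ℕ → ℕ) → Set
  EventuallyNewton f = Σ ℕ λ n₀ → Σ (List ℚ) λ cs → ∀ k → ℕ→ℚ (f (n₀ ℕ.+ k)) ≡ newton cs k

  advance : List ℚ → List ℚ
  advance []       = []
  advance (c ∷ cs) = (c + newton cs 0) ∷ advance cs

  newton-advance : ∀ cs k → newton (advance cs) k ≡ newton cs (suc k)
  newton-advance []       k       = refl
  newton-advance (c ∷ cs) zero    = refl
  newton-advance (c ∷ cs) (suc k) = cong₂ _+_ (newton-advance (c ∷ cs) k) (newton-advance cs k)

  advanceBy : ℕ → List ℚ → List ℚ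
  advanceBy zero    cs = cs
  advanceBy (suc a) cs = advance (advanceBy a cs)

  newton-advanceBy : ∀ a cs k → newton (advanceBy a cs) k ≡ newton cs (a ℕ.+ k)
  newton-advanceBy zero    cs k = refl
  newton-advanceBy (suc a) cs k = trans (newton-advance (advanceBy a cs) k)
    (trans (newton-advanceBy a cs (suc k)) (cong (newton cs) (ℕ.+-suc a k)))

  addCoeffs : List ℚ → List ℚ → List ℚ
  addCoeffs []       ds       = ds
  addCoeffs (c ∷ cs) []       = c ∷ cs
  addCoeffs (c ∷ cs) (d ∷ ds) = (c + d) ∷ addCoeffs cs ds

  newton-addCoeffs : ∀ cs ds k → newton (addCoeffs cs ds) k ≡ newton cs k + newton ds k
  newton-addCoeffs []       ds       k       = ≡-sym (ℚ.+-identityˡ _)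
  newton-addCoeffs (c ∷ cs) []       k       = ≡-sym (ℚ.+-identityʳ _)
  newton-addCoeffs (c ∷ cs) (d ∷ ds) zero    = refl
  newton-addCoeffs (c ∷ cs) (d ∷ ds) (suc k) = trans
    (cong₂ _+_ (newton-addCoeffs (c ∷ cs) (d ∷ ds) k) (newton-addCoeffs cs ds k))
    (interchange (newton (c ∷ cs) k) (newton (d ∷ ds) k) (newton cs k) (newton ds k))
    where
    open +-*-Solver
    interchange : ∀ a b c d → (a + b) + (c + d) ≡ (a + c) + (b + d)
    interchange = solve 4 (λ a b c d → (a :+ b) :+ (c :+ d) := (a :+ c) :+ (b :+ d)) refl

  EventuallyNewton-eventually : ∀ {f g} a → (∀ N → a ≤ N → f N ≡ g N) →
    EventuallyNewton g → EventuallyNewton f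
  EventuallyNewton-eventually {f} {g} a f≡g (n₀ , cs , g≡) = n₀ ℕ.+ a , advanceBy a cs , λ k → begin
    ℕ→ℚ (f (n₀ ℕ.+ a ℕ.+ k))   ≡⟨ cong ℕ→ℚ (f≡g _ (ℕ.≤-trans (ℕ.m≤n+m a n₀) (ℕ.m≤m+n _ k))) ⟩
    ℕ→ℚ (g (n₀ ℕ.+ a ℕ.+ k))   ≡⟨ cong (ℕ→ℚ ∘ g) (ℕ.+-assoc n₀ a k) ⟩
    ℕ→ℚ (g (n₀ ℕ.+ (a ℕ.+ k))) ≡⟨ g≡ (a ℕ.+ k) ⟩
    newton cs (a ℕ.+ k)        ≡⟨ ≡-sym (newton-advanceBy a cs k) ⟩
    newton (advanceBy a cs) k  ∎
    where open ≡-Reasoning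

  EventuallyNewton-zero : EventuallyNewton (λ _ → 0)
  EventuallyNewton-zero = 0 , [] , λ _ → refl

  EventuallyNewton-+ : ∀ {f g} → EventuallyNewton f → EventuallyNewton g →
    EventuallyNewton (λ N → f N ℕ.+ g N)
  EventuallyNewton-+ {f} {g} (n₀ , cs , f≡) (n₁ , ds , g≡) =
    n₀ ℕ.+ n₁ , addCoeffs (advanceBy n₁ cs) (advanceBy n₀ ds) , λ k → begin
      ℕ→ℚ (f (n₀ ℕ.+ n₁ ℕ.+ k) ℕ.+ g (n₀ ℕ.+ n₁ ℕ.+ k))
        ≡⟨ ℕ→ℚ-+ (f (n₀ ℕ.+ n₁ ℕ.+ k)) (g (n₀ ℕ.+ n₁ ℕ.+ k)) ⟩
      ℕ→ℚ (f (n₀ ℕ.+ n₁ ℕ.+ k)) + ℕ→ℚ (g (n₀ ℕ.+ n₁ ℕ.+ k))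
        ≡⟨ cong₂ _+_ (cong (ℕ→ℚ ∘ f) (ℕ.+-assoc n₀ n₁ k))
                     (cong (ℕ→ℚ ∘ g) (trans (cong (ℕ._+ k) (ℕ.+-comm n₀ n₁)) (ℕ.+-assoc n₁ n₀ k))) ⟩
      ℕ→ℚ (f (n₀ ℕ.+ (n₁ ℕ.+ k))) + ℕ→ℚ (g (n₁ ℕ.+ (n₀ ℕ.+ k)))
        ≡⟨ cong₂ _+_ (f≡ _) (g≡ _) ⟩
      newton cs (n₁ ℕ.+ k) + newton ds (n₀ ℕ.+ k)
        ≡⟨ ≡-sym (cong₂ _+_ (newton-advanceBy n₁ cs k) (newton-advanceBy n₀ ds k)) ⟩
      newton (advanceBy n₁ cs) k + newton (advanceBy n₀ ds) k
        ≡⟨ ≡-sym (newton-addCoeffs (advanceBy n₁ cs) (advanceBy n₀ ds) k) ⟩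
      newton (addCoeffs (advanceBy n₁ cs) (advanceBy n₀ ds)) k ∎
    where open ≡-Reasoning

  EventuallyNewton-∘∸ : ∀ {f} c → EventuallyNewton f → EventuallyNewton (λ N → f (N ∸ c))
  EventuallyNewton-∘∸ {f} c (n₀ , cs , f≡) = c ℕ.+ n₀ , cs , λ k →
    trans (cong (ℕ→ℚ ∘ f) (trans (cong (_∸ c) (ℕ.+-assoc c n₀ k)) (ℕ.m+n∸m≡n c (n₀ ℕ.+ k)))) (f≡ k)

  EventuallyNewton-∘suc : ∀ {f} → EventuallyNewton f → EventuallyNewton (f ∘ suc)
  EventuallyNewton-∘suc {f} (n₀ , cs , f≡) = n₀ , advance cs , λ k →
    trans (cong (ℕ→ℚ ∘ f) (≡-sym (ℕ.+-suc n₀ k))) (trans (f≡ (suc k)) (≡-sym (newton-advance cs k)))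

  EventuallyNewton-sum : ∀ {A : Set} (F : A → ℕ → ℕ) xs → (∀ {x} → x ∈ xs → EventuallyNewton (F x)) →
    EventuallyNewton (λ N → sum (map (λ x → F x N) xs))
  EventuallyNewton-sum F []       _    = EventuallyNewton-zero
  EventuallyNewton-sum F (x ∷ xs) newF =
    EventuallyNewton-+ {F x} {λ N → sum (map (λ y → F y N) xs)}
      (newF (here refl)) (EventuallyNewton-sum F xs (newF ∘ there))

  sum-applyUpTo-cong : ∀ n {f g : ℕ → ℕ} → (∀ x → f x ≡ g x) → sum (applyUpTo f n) ≡ sum (applyUpTo g n)
  sum-applyUpTo-cong zero    f≡g = refl
  sum-applyUpTo-cong (suc n) f≡g = cong₂ ℕ._+_ (f≡g 0) (sum-applyUpTo-cong n (f≡g ∘ suc))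

  sum-applyUpTo-+ : ∀ a b f → sum (applyUpTo f (a ℕ.+ b)) ≡ sum (applyUpTo f a) ℕ.+ sum (applyUpTo (f ∘ (a ℕ.+_)) b)
  sum-applyUpTo-+ zero    b f = refl
  sum-applyUpTo-+ (suc a) b f =
    trans (cong (f 0 ℕ.+_) (sum-applyUpTo-+ a b (f ∘ suc))) (≡-sym (ℕ.+-assoc (f 0) _ _))

  sum-applyUpTo-last : ∀ n f → sum (applyUpTo f (suc n)) ≡ sum (applyUpTo f n) ℕ.+ f n
  sum-applyUpTo-last n f = trans (cong (λ m → sum (applyUpTo f m)) (ℕ.+-comm 1 n))
    (trans (sum-applyUpTo-+ n 1 f) (cong (sum (applyUpTo f n) ℕ.+_) (trans (ℕ.+-identityʳ _) (cong f (ℕ.+-identityʳ n)))))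

  sum-applyUpTo-reverse : ∀ K f → sum (applyUpTo (λ i → f (K ∸ i)) (suc K)) ≡ sum (applyUpTo f (suc K))
  sum-applyUpTo-reverse zero    f = refl
  sum-applyUpTo-reverse (suc K) f = begin
    f (suc K) ℕ.+ sum (applyUpTo (λ i → f (K ∸ i)) (suc K)) ≡⟨ cong (f (suc K) ℕ.+_) (sum-applyUpTo-reverse K f) ⟩
    f (suc K) ℕ.+ sum (applyUpTo f (suc K))                 ≡⟨ ℕ.+-comm (f (suc K)) _ ⟩
    sum (applyUpTo f (suc K)) ℕ.+ f (suc K)                 ≡⟨ ≡-sym (sum-applyUpTo-last (suc K) f) ⟩
    sum (applyUpTo f (suc (suc K)))                         ∎
    where open ≡-Reasoning

  EventuallyNewton-prefixSum : ∀ {f} → EventuallyNewton f → EventuallyNewton (λ N → sum (applyUpTo f N))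
  EventuallyNewton-prefixSum {f} (n₀ , cs , f≡) = n₀ , ℕ→ℚ (sum (applyUpTo f n₀)) ∷ cs , prefix≡
    where
    prefix≡ : ∀ k → ℕ→ℚ (sum (applyUpTo f (n₀ ℕ.+ k))) ≡ newton (ℕ→ℚ (sum (applyUpTo f n₀)) ∷ cs) k
    prefix≡ zero    = cong (λ n → ℕ→ℚ (sum (applyUpTo f n))) (ℕ.+-identityʳ n₀)
    prefix≡ (suc k) = begin
      ℕ→ℚ (sum (applyUpTo f (n₀ ℕ.+ suc k)))                  ≡⟨ cong (λ n → ℕ→ℚ (sum (applyUpTo f n))) (ℕ.+-suc n₀ k) ⟩
      ℕ→ℚ (sum (applyUpTo f (suc (n₀ ℕ.+ k))))                ≡⟨ cong ℕ→ℚ (sum-applyUpTo-last (n₀ ℕ.+ k) f) ⟩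
      ℕ→ℚ (sum (applyUpTo f (n₀ ℕ.+ k)) ℕ.+ f (n₀ ℕ.+ k))     ≡⟨ ℕ→ℚ-+ (sum (applyUpTo f (n₀ ℕ.+ k))) (f (n₀ ℕ.+ k)) ⟩
      ℕ→ℚ (sum (applyUpTo f (n₀ ℕ.+ k))) + ℕ→ℚ (f (n₀ ℕ.+ k)) ≡⟨ cong₂ _+_ (prefix≡ k) (f≡ k) ⟩
      newton (ℕ→ℚ (sum (applyUpTo f n₀)) ∷ cs) (suc k)        ∎
      where open ≡-Reasoning

  EventuallyNewton-convolution : ∀ a (F : ℕ → ℕ → ℕ) → (∀ x → EventuallyNewton (F x)) →
    EventuallyNewton (λ N → sum (applyUpTo (λ x → F x (N ∸ x)) a))
  EventuallyNewton-convolution zero    F newF = EventuallyNewton-zero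
  EventuallyNewton-convolution (suc a) F newF = EventuallyNewton-eventually 0
    (λ N _ → cong (F 0 N ℕ.+_) (sum-applyUpTo-cong a (λ x → cong (F (suc x)) (∸-suc N x))))
    (EventuallyNewton-+ {F 0} {λ N → sum (applyUpTo (λ x → F (suc x) (N ∸ 1 ∸ x)) a)} (newF 0)
      (EventuallyNewton-∘∸ {λ M → sum (applyUpTo (λ x → F (suc x) (M ∸ x)) a)} 1
        (EventuallyNewton-convolution a (F ∘ suc) (newF ∘ suc))))
    where
    ∸-suc : ∀ N x → N ∸ suc x ≡ N ∸ 1 ∸ x
    ∸-suc zero    x = ≡-sym (ℕ.0∸n≡0 x)
    ∸-suc (suc N) x = refl

module Polynomials where

  open Newton using (newton; EventuallyNewton; ℕ→ℚ≡mkℚ; ℕ→ℚ-suc)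
  open import Data.Nat.Base as ℕ using (ℕ; zero; suc; _∸_; _≥_)
  import Data.Nat.Properties as ℕ
  import Data.Integer.Base as ℤ
  open import Data.Rational.Base using (ℚ; mkℚ; 0ℚ; 1ℚ; _+_; _*_; -_; _-_; 1/_)
  import Data.Rational.Properties as ℚ
  open import Data.Rational.Solver using (module +-*-Solver)
  open import Data.Nat.Coprimality using (1-coprimeTo; sym)
  open import Data.List.Base using (List; []; _∷_)
  open import Data.Product using (Σ; _,_)
  open import Function using (_∘_)
  open import Relation.Binary.PropositionalEquality
    using (_≡_; refl; trans; cong; cong₂; module ≡-Reasoning) renaming (sym to ≡-sym)

  open +-*-Solver

  _⊕_ : Poly → Poly → Poly
  []       ⊕ q        = q
  (a ∷ p) ⊕ []       = a ∷ p
  (a ∷ p) ⊕ (b ∷ q) = (a + b) ∷ (p ⊕ q)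

  _·_ : ℚ → Poly → Poly
  c · []      = []
  c · (a ∷ p) = (c * a) ∷ (c · p)

  infixl 6 _⊕_
  infixr 7 _·_

  eval-⊕ : ∀ p q x → eval (p ⊕ q) x ≡ eval p x + eval q x
  eval-⊕ []      q       x = ≡-sym (ℚ.+-identityˡ _)
  eval-⊕ (a ∷ p) []      x = ≡-sym (ℚ.+-identityʳ _)
  eval-⊕ (a ∷ p) (b ∷ q) x = trans (cong (λ t → (a + b) + x * t) (eval-⊕ p q x)) (distrib a b x (eval p x) (eval q x))
    where
    distrib : ∀ a b x P Q → (a + b) + x * (P + Q) ≡ (a + x * P) + (b + x * Q)
    distrib = solve 5 (λ a b x P Q → (a :+ b) :+ x :* (P :+ Q) := (a :+ x :* P) :+ (b :+ x :* Q)) refl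

  eval-· : ∀ c p x → eval (c · p) x ≡ c * eval p x
  eval-· c []      x = ≡-sym (ℚ.*-zeroʳ c)
  eval-· c (a ∷ p) x = trans (cong (λ t → c * a + x * t) (eval-· c p x)) (distrib c a x (eval p x))
    where
    distrib : ∀ c a x P → c * a + x * (c * P) ≡ c * (a + x * P)
    distrib = solve 4 (λ c a x P → c :* a :+ x :* (c :* P) := c :* (a :+ x :* P)) refl

  timesLinear : ℚ → Poly → Poly
  timesLinear c p = (0ℚ ∷ p) ⊕ (- c) · p

  eval-timesLinear : ∀ c p x → eval (timesLinear c p) x ≡ (x - c) * eval p x
  eval-timesLinear c p x = trans (eval-⊕ (0ℚ ∷ p) ((- c) · p) x)
    (trans (cong ((0ℚ + x * eval p x) +_) (eval-· (- c) p x)) (factor c x (eval p x)))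
    where
    factor : ∀ c x P → 0ℚ + x * P + (- c) * P ≡ (x - c) * P
    factor = solve 3 (λ c x P → con 0ℚ :+ x :* P :+ (:- c) :* P := (x :- c) :* P) refl

  reciprocal : ℕ → ℚ
  reciprocal i = 1/ mkℚ (ℤ.+ suc i) 0 (sym (1-coprimeTo (suc i)))

  reciprocal-cancel : ∀ i x → reciprocal i * (ℕ→ℚ (suc i) * x) ≡ x
  reciprocal-cancel i x rewrite ℕ→ℚ≡mkℚ (suc i) = begin
    r * (a * x) ≡⟨ ≡-sym (ℚ.*-assoc r a x) ⟩
    (r * a) * x ≡⟨ cong (_* x) (ℚ.*-inverseˡ a) ⟩
    1ℚ * x      ≡⟨ ℚ.*-identityˡ x ⟩
    x           ∎
    where
    open ≡-Reasoning
    a = mkℚ (ℤ.+ suc i) 0 (sym (1-coprimeTo (suc i)))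
    r = 1/ a

  module BinomialBasis (b : ℕ) where

    node : ℕ → ℚ
    node i = ℕ→ℚ (b ℕ.+ i)

    node-suc : ∀ i → node (suc i) ≡ node i + 1ℚ
    node-suc i = trans (cong ℕ→ℚ (ℕ.+-suc b i)) (ℕ→ℚ-suc (b ℕ.+ i))

    -- eval (binomial i) y = C(y - b, i) = ∏_{t<i} (y - (b + t)) / (t + 1).
    binomial : ℕ → Poly
    binomial zero    = 1ℚ ∷ []
    binomial (suc i) = reciprocal i · timesLinear (node i) (binomial i)

    binom : ℕ → ℚ → ℚ
    binom i y = eval (binomial i) y

    binom-zero : ∀ y → binom 0 y ≡ 1ℚ
    binom-zero = solve 1 (λ y → con 1ℚ :+ y :* con 0ℚ := con 1ℚ) refl

    binom-suc : ∀ i y → binom (suc i) y ≡ reciprocal i * ((y - node i) * binom i y)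
    binom-suc i y = trans (eval-· (reciprocal i) (timesLinear (node i) (binomial i)) y)
                      (cong (reciprocal i *_) (eval-timesLinear (node i) (binomial i) y))

    binom-recurrence : ∀ i y → ℕ→ℚ (suc i) * binom (suc i) y ≡ (y - node i) * binom i y
    binom-recurrence i y = begin
      a * binom (suc i) y ≡⟨ cong (a *_) (binom-suc i y) ⟩
      a * (r * X)         ≡⟨ swap a r X ⟩
      r * (a * X)         ≡⟨ reciprocal-cancel i X ⟩
      X                   ∎
      where
      open ≡-Reasoning
      a = ℕ→ℚ (suc i)
      r = reciprocal i
      X = (y - node i) * binom i y
      swap : ∀ a r X → a * (r * X) ≡ r * (a * X)
      swap = solve 3 (λ a r X → a :* (r :* X) := r :* (a :* X)) refl

    binom-pascal : ∀ i y → binom (suc i) (y + 1ℚ) ≡ binom (suc i) y + binom i y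
    binom-pascal zero y = begin
      binom 1 (y + 1ℚ)                      ≡⟨ binom-suc 0 (y + 1ℚ) ⟩
      r * ((y + 1ℚ - c) * binom 0 (y + 1ℚ)) ≡⟨ cong (λ t → r * ((y + 1ℚ - c) * t)) (binom-zero (y + 1ℚ)) ⟩
      r * ((y + 1ℚ - c) * 1ℚ)               ≡⟨ split r c y ⟩
      r * ((y - c) * 1ℚ) + r * (1ℚ * 1ℚ)    ≡⟨ cong (r * ((y - c) * 1ℚ) +_) (reciprocal-cancel 0 1ℚ) ⟩
      r * ((y - c) * 1ℚ) + 1ℚ               ≡⟨ ≡-sym (cong₂ (λ s t → r * ((y - c) * s) + t) (binom-zero y) (binom-zero y)) ⟩
      r * ((y - c) * binom 0 y) + binom 0 y ≡⟨ ≡-sym (cong (_+ binom 0 y) (binom-suc 0 y)) ⟩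
      binom 1 y + binom 0 y                 ∎
      where
      open ≡-Reasoning
      r = reciprocal 0
      c = node 0
      split : ∀ r c y → r * ((y + 1ℚ - c) * 1ℚ) ≡ r * ((y - c) * 1ℚ) + r * (1ℚ * 1ℚ)
      split = solve 3 (λ r c y → r :* ((y :+ con 1ℚ :- c) :* con 1ℚ) := r :* ((y :- c) :* con 1ℚ) :+ r :* (con 1ℚ :* con 1ℚ)) refl
    binom-pascal (suc i) y = begin
      binom (2 ℕ.+ i) (y + 1ℚ)
        ≡⟨ binom-suc (suc i) (y + 1ℚ) ⟩
      r * ((y + 1ℚ - node (suc i)) * binom (suc i) (y + 1ℚ))
        ≡⟨ cong₂ (λ s t → r * ((y + 1ℚ - s) * t)) (node-suc i) (binom-pascal i y) ⟩
      r * ((y + 1ℚ - (c + 1ℚ)) * (B₁ + B₀))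
        ≡⟨ expand r c y B₁ B₀ ⟩
      r * ((y - c) * B₁ + (y - c) * B₀)
        ≡⟨ cong (λ t → r * ((y - c) * B₁ + t)) (≡-sym (binom-recurrence i y)) ⟩
      r * ((y - c) * B₁ + a * B₁)
        ≡⟨ regroup r c y a B₁ ⟩
      r * ((y - (c + 1ℚ)) * B₁) + r * ((a + 1ℚ) * B₁)
        ≡⟨ cong₂ (λ s t → r * ((y - s) * B₁) + r * (t * B₁)) (≡-sym (node-suc i)) (≡-sym (ℕ→ℚ-suc (suc i))) ⟩
      r * ((y - node (suc i)) * B₁) + r * (ℕ→ℚ (2 ℕ.+ i) * B₁)
        ≡⟨ cong₂ _+_ (≡-sym (binom-suc (suc i) y)) (reciprocal-cancel (suc i) B₁) ⟩
      binom (2 ℕ.+ i) y + B₁ ∎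
      where
      open ≡-Reasoning
      r = reciprocal (suc i)
      a = ℕ→ℚ (suc i)
      c = node i
      B₁ = binom (suc i) y
      B₀ = binom i y
      expand : ∀ r c y B₁ B₀ → r * ((y + 1ℚ - (c + 1ℚ)) * (B₁ + B₀)) ≡ r * ((y - c) * B₁ + (y - c) * B₀)
      expand = solve 5 (λ r c y B₁ B₀ → r :* ((y :+ con 1ℚ :- (c :+ con 1ℚ)) :* (B₁ :+ B₀))
                                     := r :* ((y :- c) :* B₁ :+ (y :- c) :* B₀)) refl
      regroup : ∀ r c y a B₁ → r * ((y - c) * B₁ + a * B₁) ≡ r * ((y - (c + 1ℚ)) * B₁) + r * ((a + 1ℚ) * B₁)
      regroup = solve 5 (λ r c y a B₁ → r :* ((y :- c) :* B₁ :+ a :* B₁)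
                                     := r :* ((y :- (c :+ con 1ℚ)) :* B₁) :+ r :* ((a :+ con 1ℚ) :* B₁)) refl

    binom-vanishes-at-base : ∀ i → binom (suc i) (ℕ→ℚ b) ≡ 0ℚ
    binom-vanishes-at-base zero = begin
      binom 1 (ℕ→ℚ b)
        ≡⟨ binom-suc 0 (ℕ→ℚ b) ⟩
      reciprocal 0 * ((ℕ→ℚ b - node 0) * binom 0 (ℕ→ℚ b))
        ≡⟨ cong (λ n → reciprocal 0 * ((ℕ→ℚ b - ℕ→ℚ n) * binom 0 (ℕ→ℚ b))) (ℕ.+-identityʳ b) ⟩
      reciprocal 0 * ((ℕ→ℚ b - ℕ→ℚ b) * binom 0 (ℕ→ℚ b))
        ≡⟨ cancel (reciprocal 0) (ℕ→ℚ b) (binom 0 (ℕ→ℚ b)) ⟩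
      0ℚ ∎
      where
      open ≡-Reasoning
      cancel : ∀ r y X → r * ((y - y) * X) ≡ 0ℚ
      cancel = solve 3 (λ r y X → r :* ((y :- y) :* X) := con 0ℚ) refl
    binom-vanishes-at-base (suc i) =
      trans (binom-suc (suc i) (ℕ→ℚ b))
        (trans (cong (λ t → reciprocal (suc i) * ((ℕ→ℚ b - node (suc i)) * t)) (binom-vanishes-at-base i))
               (annihilate (reciprocal (suc i)) (ℕ→ℚ b - node (suc i))))
      where
      annihilate : ∀ r z → r * (z * 0ℚ) ≡ 0ℚ
      annihilate = solve 2 (λ r z → r :* (z :* con 0ℚ) := con 0ℚ) refl

    newtonPolyFrom : ℕ → List ℚ → Poly
    newtonPolyFrom j []       = []
    newtonPolyFrom j (c ∷ cs) = c · binomial j ⊕ newtonPolyFrom (suc j) cs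

    series : ℕ → List ℚ → ℚ → ℚ
    series j cs y = eval (newtonPolyFrom j cs) y

    series-∷ : ∀ j c cs y → series j (c ∷ cs) y ≡ c * binom j y + series (suc j) cs y
    series-∷ j c cs y = trans (eval-⊕ (c · binomial j) (newtonPolyFrom (suc j) cs) y)
                         (cong (_+ series (suc j) cs y) (eval-· c (binomial j) y))

    series-pascal : ∀ j cs y → series (suc j) cs (y + 1ℚ) ≡ series (suc j) cs y + series j cs y
    series-pascal j []       y = ≡-sym (ℚ.+-identityʳ 0ℚ)
    series-pascal j (c ∷ cs) y = begin
      series (suc j) (c ∷ cs) (y + 1ℚ)
        ≡⟨ series-∷ (suc j) c cs (y + 1ℚ) ⟩
      c * binom (suc j) (y + 1ℚ) + series (2 ℕ.+ j) cs (y + 1ℚ)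
        ≡⟨ cong₂ (λ s t → c * s + t) (binom-pascal j y) (series-pascal (suc j) cs y) ⟩
      c * (binom (suc j) y + binom j y) + (series (2 ℕ.+ j) cs y + series (suc j) cs y)
        ≡⟨ interchange c (binom (suc j) y) (binom j y) (series (2 ℕ.+ j) cs y) (series (suc j) cs y) ⟩
      (c * binom (suc j) y + series (2 ℕ.+ j) cs y) + (c * binom j y + series (suc j) cs y)
        ≡⟨ ≡-sym (cong₂ _+_ (series-∷ (suc j) c cs y) (series-∷ j c cs y)) ⟩
      series (suc j) (c ∷ cs) y + series j (c ∷ cs) y ∎
      where
      open ≡-Reasoning
      interchange : ∀ c A B X Y → c * (A + B) + (X + Y) ≡ (c * A + X) + (c * B + Y)
      interchange = solve 5 (λ c A B X Y → c :* (A :+ B) :+ (X :+ Y) := (c :* A :+ X) :+ (c :* B :+ Y)) refl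

    series-vanishes-at-base : ∀ j cs → series (suc j) cs (ℕ→ℚ b) ≡ 0ℚ
    series-vanishes-at-base j []       = refl
    series-vanishes-at-base j (c ∷ cs) = trans (series-∷ (suc j) c cs (ℕ→ℚ b))
      (trans (cong₂ (λ s t → c * s + t) (binom-vanishes-at-base j) (series-vanishes-at-base (suc j) cs)) (annihilate c))
      where
      annihilate : ∀ c → c * 0ℚ + 0ℚ ≡ 0ℚ
      annihilate = solve 1 (λ c → c :* con 0ℚ :+ con 0ℚ := con 0ℚ) refl

    eval-newtonPoly : ∀ cs k → series 0 cs (ℕ→ℚ (b ℕ.+ k)) ≡ newton cs k
    eval-newtonPoly []       k       = refl
    eval-newtonPoly (c ∷ cs) zero    = begin
      series 0 (c ∷ cs) (ℕ→ℚ (b ℕ.+ 0))         ≡⟨ cong (series 0 (c ∷ cs) ∘ ℕ→ℚ) (ℕ.+-identityʳ b) ⟩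
      series 0 (c ∷ cs) (ℕ→ℚ b)                 ≡⟨ series-∷ 0 c cs (ℕ→ℚ b) ⟩
      c * binom 0 (ℕ→ℚ b) + series 1 cs (ℕ→ℚ b) ≡⟨ cong₂ (λ s t → c * s + t) (binom-zero (ℕ→ℚ b)) (series-vanishes-at-base 0 cs) ⟩
      c * 1ℚ + 0ℚ                               ≡⟨ unit c ⟩
      c                                         ∎
      where
      open ≡-Reasoning
      unit : ∀ c → c * 1ℚ + 0ℚ ≡ c
      unit = solve 1 (λ c → c :* con 1ℚ :+ con 0ℚ := c) refl
    eval-newtonPoly (c ∷ cs) (suc k) = begin
      series 0 (c ∷ cs) (ℕ→ℚ (b ℕ.+ suc k))
        ≡⟨ cong (series 0 (c ∷ cs)) (trans (cong ℕ→ℚ (ℕ.+-suc b k)) (ℕ→ℚ-suc (b ℕ.+ k))) ⟩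
      series 0 (c ∷ cs) (y + 1ℚ)
        ≡⟨ series-∷ 0 c cs (y + 1ℚ) ⟩
      c * binom 0 (y + 1ℚ) + series 1 cs (y + 1ℚ)
        ≡⟨ cong₂ (λ s t → c * s + t) (trans (binom-zero (y + 1ℚ)) (≡-sym (binom-zero y))) (series-pascal 0 cs y) ⟩
      c * binom 0 y + (series 1 cs y + series 0 cs y)
        ≡⟨ ≡-sym (ℚ.+-assoc (c * binom 0 y) (series 1 cs y) (series 0 cs y)) ⟩
      (c * binom 0 y + series 1 cs y) + series 0 cs y
        ≡⟨ cong (_+ series 0 cs y) (≡-sym (series-∷ 0 c cs y)) ⟩
      series 0 (c ∷ cs) y + series 0 cs y
        ≡⟨ cong₂ _+_ (eval-newtonPoly (c ∷ cs) k) (eval-newtonPoly cs k) ⟩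
      newton (c ∷ cs) (suc k) ∎
      where
      open ≡-Reasoning
      y = ℕ→ℚ (b ℕ.+ k)

  EventuallyNewton⇒polynomial : ∀ {f} → EventuallyNewton f →
    Σ Poly λ P → Σ ℕ λ n₀ → ∀ n → n ≥ n₀ → ℕ→ℚ (f n) ≡ eval P (ℕ→ℚ n)
  EventuallyNewton⇒polynomial {f} (n₀ , cs , f≡) = newtonPolyFrom 0 cs , n₀ , λ n n≥n₀ → begin
    ℕ→ℚ (f n)                           ≡⟨ cong (ℕ→ℚ ∘ f) (≡-sym (ℕ.m+[n∸m]≡n n≥n₀)) ⟩
    ℕ→ℚ (f (n₀ ℕ.+ (n ∸ n₀)))           ≡⟨ f≡ (n ∸ n₀) ⟩
    newton cs (n ∸ n₀)                  ≡⟨ ≡-sym (eval-newtonPoly cs (n ∸ n₀)) ⟩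
    series 0 cs (ℕ→ℚ (n₀ ℕ.+ (n ∸ n₀))) ≡⟨ cong (series 0 cs ∘ ℕ→ℚ) (ℕ.m+[n∸m]≡n n≥n₀) ⟩
    eval (newtonPolyFrom 0 cs) (ℕ→ℚ n)  ∎
    where
    open ≡-Reasoning
    open BinomialBasis n₀

module Counting where

  open ListFacts
  open Enumerations using (compositions; ∈-compositions⁻)
  open Newton
  open import Level using (0ℓ)
  open import Axiom.ExcludedMiddle using (ExcludedMiddle)
  open import Data.Bool.Base using (Bool; true; false; T)
  open import Data.Nat.Base using (ℕ; zero; suc; _+_; _∸_; _≤_; _<_; _⊔_; s≤s)
  open import Data.Nat.Properties
  open import Data.Nat.ListAction using (sum)
  open import Data.List.Base using (List; []; _∷_; map; length; upTo; applyUpTo)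
  open import Data.List.Properties using (length-map; map-applyUpTo)
  open import Data.Product using (Σ; ∃; _,_; proj₁; proj₂)
  open import Data.Sum using (inj₁; inj₂)
  open import Function using (_∘_; mk⇔)
  open import Relation.Nullary using (¬_; yes; no; contradiction)
  open import Relation.Nullary.Decidable using (isYes; toWitness; fromWitness)
  open import Relation.Binary.PropositionalEquality
    using (_≡_; refl; sym; trans; cong; subst; module ≡-Reasoning)

  incrementAt : ℕ → List ℕ → List ℕ
  incrementAt j       []      = []
  incrementAt zero    (x ∷ g) = suc x ∷ g
  incrementAt (suc j) (x ∷ g) = x ∷ incrementAt j g

  DownwardClosed : (List ℕ → Bool) → Set
  DownwardClosed D = ∀ j g → T (D (incrementAt j g)) → T (D g)

  Antitone : (ℕ → List ℕ → Bool) → Set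
  Antitone F = ∀ x h → T (F (suc x) h) → T (F x h)

  antitone-≤ : ∀ {F} → Antitone F → ∀ {x x′} → x ≤ x′ → ∀ h → T (F x′ h) → T (F x h)
  antitone-≤ {F} anti {x} x≤x′ h with o , refl ← m≤n⇒∃[o]m+o≡n x≤x′ = go o
    where
    go : ∀ o → T (F (x + o) h) → T (F x h)
    go zero    = subst (λ z → T (F z h)) (+-identityʳ x)
    go (suc o) = go o ∘ anti (x + o) h ∘ subst (λ z → T (F z h)) (+-suc x o)

  Stabilises : ℕ → (ℕ → List ℕ → Bool) → Set
  Stabilises k F = Σ ℕ λ x₀ → ∀ x → x₀ ≤ x → ∀ h → length h ≡ k → F x h ≡ F x₀ h

  count : (List ℕ → Bool) → ℕ → ℕ → ℕ
  count D k N = length (filterᵇ D (compositions k N))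

  count-suc : ∀ D k N → count D (suc k) N ≡ sum (applyUpTo (λ x → count (D ∘ (x ∷_)) k (N ∸ x)) (suc N))
  count-suc D k N = begin
    count D (suc k) N
      ≡⟨ length-filterᵇ-concatMap D (λ x → map (x ∷_) (compositions k (N ∸ x))) (upTo (suc N)) ⟩
    sum (map (λ x → length (filterᵇ D (map (x ∷_) (compositions k (N ∸ x))))) (upTo (suc N)))
      ≡⟨ cong sum (map-applyUpTo (λ x → x) _ (suc N)) ⟩
    sum (applyUpTo (λ x → length (filterᵇ D (map (x ∷_) (compositions k (N ∸ x))))) (suc N))
      ≡⟨ sum-applyUpTo-cong (suc N) (λ x → trans
           (cong length (filterᵇ-map D (x ∷_) (compositions k (N ∸ x))))
           (length-map (x ∷_) (filterᵇ (D ∘ (x ∷_)) (compositions k (N ∸ x))))) ⟩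
    sum (applyUpTo (λ x → count (D ∘ (x ∷_)) k (N ∸ x)) (suc N)) ∎
    where open ≡-Reasoning

  module _ (lem : ExcludedMiddle 0ℓ) where

    stabilises-[] : ∀ F → Antitone F → Stabilises 0 F
    stabilises-[] F anti with lem {∃ λ x → ¬ T (F x [])}
    ... | yes (x₀ , ¬Fx₀) = x₀ , λ { x x₀≤x [] refl →
            T-injective (mk⇔ (λ Fx → contradiction (antitone-≤ anti x₀≤x [] Fx) ¬Fx₀)
                             (λ Fx₀ → contradiction Fx₀ ¬Fx₀)) }
    ... | no ∄ = 0 , λ { x _ [] refl → T-injective (mk⇔ (λ _ → always 0) (λ _ → always x)) }
      where
      always : ∀ x → T (F x [])
      always x with F x [] in eq
      ... | true  = _
      ... | false = contradiction (x , subst (λ b → ¬ T b) (sym eq) (λ ())) ∄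

    -- The limit of the family at y ∷ h is decided classically; it is again a downward closed
    -- antitone family (in y), so it stabilises by induction, and so does each slice F _ (y ∷ _).
    -- Beyond the stabilisation point y₀ of the limit, F agrees with the limit.
    module Cons (k : ℕ) (stabilisesₖ : ∀ F → (∀ x → DownwardClosed (F x)) → Antitone F → Stabilises k F)
                (F : ℕ → List ℕ → Bool) (closed : ∀ x → DownwardClosed (F x)) (anti : Antitone F) where

      limit : ℕ → List ℕ → Bool
      limit y h = isYes (lem {∀ x → T (F x (y ∷ h))})

      limit⇒F : ∀ {y h} x → T (limit y h) → T (F x (y ∷ h))
      limit⇒F x l = toWitness l x

      F⇒limit : ∀ {y h} → (∀ x → T (F x (y ∷ h))) → T (limit y h)
      F⇒limit = fromWitness

      F-antitoneʰ : ∀ x {y y′} → y ≤ y′ → ∀ h → T (F x (y′ ∷ h)) → T (F x (y ∷ h))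
      F-antitoneʰ x = antitone-≤ {λ z h → F x (z ∷ h)} (λ z h → closed x 0 (z ∷ h))

      slice : ℕ → ℕ → List ℕ → Bool
      slice y x h = F x (y ∷ h)

      sliceStable : ∀ y → Stabilises k (slice y)
      sliceStable y = stabilisesₖ (slice y) (λ x j h → closed x (suc j) (y ∷ h)) (λ x h → anti x (y ∷ h))

      limitStable : Stabilises k limit
      limitStable = stabilisesₖ limit
        (λ y j h l → F⇒limit (λ x → closed x (suc j) (y ∷ h) (limit⇒F x l)))
        (λ y h l → F⇒limit (λ x → closed x 0 (y ∷ h) (limit⇒F x l)))

      y₀ = proj₁ limitStable

      x[_] : ℕ → ℕ
      x[ y ] = proj₁ (sliceStable y)

      bound : ℕ → ℕ
      bound zero    = 0
      bound (suc n) = bound n ⊔ x[ n ]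

      x≤bound : ∀ {y n} → y < n → x[ y ] ≤ bound n
      x≤bound {y} {suc n} (s≤s y≤n) with m≤n⇒m<n∨m≡n y≤n
      ... | inj₁ y<n  = ≤-trans (x≤bound y<n) (m≤m⊔n (bound n) _)
      ... | inj₂ refl = m≤n⊔m (bound n) _

      X = x[ y₀ ] ⊔ bound y₀

      F≡limit-at-y₀ : ∀ x → x[ y₀ ] ≤ x → ∀ h → length h ≡ k → F x (y₀ ∷ h) ≡ limit y₀ h
      F≡limit-at-y₀ x x≥ h len = T-injective (mk⇔ (λ Fx → F⇒limit (λ x′ → everywhere x′ Fx)) (limit⇒F x))
        where
        everywhere : ∀ x′ → T (F x (y₀ ∷ h)) → T (F x′ (y₀ ∷ h))
        everywhere x′ Fx with x[ y₀ ] ≤? x′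
        ... | yes x′≥ = subst T (trans (proj₂ (sliceStable y₀) x x≥ h len) (sym (proj₂ (sliceStable y₀) x′ x′≥ h len))) Fx
        ... | no  x′≱ = antitone-≤ anti (≤-trans (<⇒≤ (≰⇒> x′≱)) x≥) (y₀ ∷ h) Fx

      F≡limit : ∀ x → x[ y₀ ] ≤ x → ∀ y → y₀ ≤ y → ∀ h → length h ≡ k → F x (y ∷ h) ≡ limit y h
      F≡limit x x≥ y y≥ h len = T-injective (mk⇔
        (λ Fx → subst T (sym (proj₂ limitStable y y≥ h len))
                  (subst T (F≡limit-at-y₀ x x≥ h len) (F-antitoneʰ x y≥ h Fx)))
        (limit⇒F x))

      stabilises-∷ : Stabilises (suc k) F
      stabilises-∷ = X , stable
        where
        stable : ∀ x → X ≤ x → ∀ h → length h ≡ suc k → F x h ≡ F X h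
        stable x X≤x (y ∷ h) len with y₀ ≤? y
        ... | yes y≥ = trans (F≡limit x (≤-trans (m≤m⊔n _ _) X≤x) y y≥ h (suc-injective len))
                             (sym (F≡limit X (m≤m⊔n _ _) y y≥ h (suc-injective len)))
        ... | no  y≱ = trans (proj₂ (sliceStable y) x (≤-trans x≤X X≤x) h (suc-injective len))
                             (sym (proj₂ (sliceStable y) X x≤X h (suc-injective len)))
          where
          x≤X : x[ y ] ≤ X
          x≤X = ≤-trans (x≤bound (≰⇒> y≱)) (m≤n⊔m _ _)

    stabilises : ∀ k F → (∀ x → DownwardClosed (F x)) → Antitone F → Stabilises k F
    stabilises zero    F _      anti = stabilises-[] F anti
    stabilises (suc k) F closed anti = Cons.stabilises-∷ k (stabilises k) F closed anti

    count-eventuallyNewton : ∀ k D → DownwardClosed D → EventuallyNewton (count D k)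
    count-eventuallyNewton zero    D _      =
      EventuallyNewton-eventually {count D 0} {λ _ → 0} 1 (λ { (suc N) _ → refl }) EventuallyNewton-zero
    count-eventuallyNewton (suc k) D closed =
      EventuallyNewton-eventually {count D (suc k)} {total} x₀ count≡total
        (EventuallyNewton-+ {λ N → sum (applyUpTo (λ x → c x (N ∸ x)) x₀)} {λ N → sum (applyUpTo (c x₀) (suc (N ∸ x₀)))}
          (EventuallyNewton-convolution x₀ c (λ x → count-eventuallyNewton k (D ∘ (x ∷_)) (closedAt x)))
          (EventuallyNewton-∘∸ {λ M → sum (applyUpTo (c x₀) (suc M))} x₀
            (EventuallyNewton-∘suc {λ M → sum (applyUpTo (c x₀) M)}
              (EventuallyNewton-prefixSum (count-eventuallyNewton k (D ∘ (x₀ ∷_)) (closedAt x₀))))))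
      where
      closedAt : ∀ x → DownwardClosed (D ∘ (x ∷_))
      closedAt x j h = closed (suc j) (x ∷ h)

      stable = stabilises k (λ x → D ∘ (x ∷_)) closedAt (λ x h → closed 0 (x ∷ h))
      x₀ = proj₁ stable

      c : ℕ → ℕ → ℕ
      c x M = count (D ∘ (x ∷_)) k M

      c-stable : ∀ i M → c (x₀ + i) M ≡ c x₀ M
      c-stable i M = cong length (filterᵇ-cong-local _ _ (compositions k M)
        (λ h∈ → proj₂ stable (x₀ + i) (m≤m+n x₀ i) _ (proj₁ (∈-compositions⁻ k M h∈))))

      total : ℕ → ℕ
      total N = sum (applyUpTo (λ x → c x (N ∸ x)) x₀) + sum (applyUpTo (c x₀) (suc (N ∸ x₀)))

      count≡total : ∀ N → x₀ ≤ N → count D (suc k) N ≡ total N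
      count≡total N x₀≤N with K , refl ← m≤n⇒∃[o]m+o≡n x₀≤N = begin
        count D (suc k) (x₀ + K)
          ≡⟨ count-suc D k (x₀ + K) ⟩
        sum (applyUpTo G (suc (x₀ + K)))
          ≡⟨ cong (sum ∘ applyUpTo G) (sym (+-suc x₀ K)) ⟩
        sum (applyUpTo G (x₀ + suc K))
          ≡⟨ sum-applyUpTo-+ x₀ (suc K) G ⟩
        Σ₀ + sum (applyUpTo (G ∘ (x₀ +_)) (suc K))
          ≡⟨ cong (Σ₀ +_) (sum-applyUpTo-cong (suc K) tail≡) ⟩
        Σ₀ + sum (applyUpTo (λ i → c x₀ (K ∸ i)) (suc K))
          ≡⟨ cong (Σ₀ +_) (sum-applyUpTo-reverse K (c x₀)) ⟩
        Σ₀ + sum (applyUpTo (c x₀) (suc K))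
          ≡⟨ cong (λ z → Σ₀ + sum (applyUpTo (c x₀) (suc z))) (sym (m+n∸m≡n x₀ K)) ⟩
        total (x₀ + K) ∎
        where
        open ≡-Reasoning
        G = λ x → c x (x₀ + K ∸ x)
        Σ₀ = sum (applyUpTo G x₀)
        tail≡ : ∀ i → G (x₀ + i) ≡ c x₀ (K ∸ i)
        tail≡ i = trans (c-stable i _) (cong (c x₀) ([m+n]∸[m+o]≡n∸o x₀ K i))

module Standardisation where

  open ListFacts
  open Enumerations
  open import Data.Bool.Base using (true; false; T; not; if_then_else_)
  open import Data.Empty using (⊥-elim)
  open import Data.Nat.Base using (ℕ; zero; suc; _+_; _∸_; _≤_; _<_; _<ᵇ_; z≤n; s≤s)
  open import Data.Nat.Properties
  open import Data.List.Base using (List; []; _∷_; _++_; map; length)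
  open import Data.List.Properties using (length-map; map-∘; map-cong-local; ++-identityʳ)
  open import Data.List.Membership.Propositional using (_∈_; find; lose)
  open import Data.List.Membership.DecPropositional _≟_ using (_∈?_)
  open import Data.List.Membership.Propositional.Properties using (∈-++⁺ˡ; ∈-++⁺ʳ; ∈-++⁻; ∈-map⁺; ∈-map⁻)
  open import Data.List.Relation.Unary.Any using (here; there)
  open import Data.List.Relation.Unary.Any.Properties using (any⁺; any⁻)
  open import Data.List.Relation.Unary.All as All using (All; []; _∷_)
  open import Data.List.Relation.Unary.AllPairs as AllPairs using (AllPairs; []; _∷_)
  open import Data.List.Relation.Unary.Unique.Propositional using (Unique)
  open import Data.List.Relation.Binary.Sublist.Propositional as Sublist using (_⊆_; []; _∷_; _∷ʳ_; ⊆-trans)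
  open import Data.List.Relation.Binary.Sublist.Propositional.Properties using (map⁺)
  open import Data.Product using (_×_; _,_; proj₁; proj₂)
  open import Data.Sum using (inj₁; inj₂)
  open import Function using (_∘_; mk⇔)
  open import Relation.Binary.Core using (_Preserves_⟶_)
  open import Relation.Binary.Definitions using (tri<; tri≈; tri>)
  open import Relation.Nullary using (¬_; yes; no; contradiction)
  open import Relation.Binary.PropositionalEquality
    using (_≡_; _≢_; refl; sym; trans; cong; cong₂; subst; module ≡-Reasoning)

  <⇒<ᵇ≡true : ∀ {m n} → m < n → (m <ᵇ n) ≡ true
  <⇒<ᵇ≡true m<n = T-injective (mk⇔ _ (λ _ → <⇒<ᵇ m<n))

  ≮⇒<ᵇ≡false : ∀ {m n} → ¬ m < n → (m <ᵇ n) ≡ false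
  ≮⇒<ᵇ≡false {m} {n} m≮n = T-injective (mk⇔ (m≮n ∘ <ᵇ⇒< m n) λ ())

  module _ {f : ℕ → ℕ} (mono : f Preserves _<_ ⟶ _<_) where

    strictMono⇒≤ : f Preserves _≤_ ⟶ _≤_
    strictMono⇒≤ x≤y with m≤n⇒m<n∨m≡n x≤y
    ... | inj₁ x<y  = <⇒≤ (mono x<y)
    ... | inj₂ refl = ≤-refl

    strictMono⇒injective : ∀ {x y} → f x ≡ f y → x ≡ y
    strictMono⇒injective {x} {y} fx≡fy with <-cmp x y
    ... | tri< x<y _ _ = contradiction fx≡fy (<⇒≢ (mono x<y))
    ... | tri≈ _ x≡y _ = x≡y
    ... | tri> _ _ y<x = contradiction (sym fx≡fy) (<⇒≢ (mono y<x))

    strictMono-reflects-< : ∀ {x y} → f x < f y → x < y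
    strictMono-reflects-< {x} {y} fx<fy with x <? y
    ... | yes x<y = x<y
    ... | no  x≮y = contradiction (strictMono⇒≤ (≮⇒≥ x≮y)) (<⇒≱ fx<fy)

    strictMono-<ᵇ : ∀ x y → (f x <ᵇ f y) ≡ (x <ᵇ y)
    strictMono-<ᵇ x y = T-injective (mk⇔
      (<⇒<ᵇ ∘ strictMono-reflects-< ∘ <ᵇ⇒< (f x) (f y))
      (<⇒<ᵇ ∘ mono ∘ <ᵇ⇒< x y))

    Increasing-map : ∀ {xs} → Increasing xs → Increasing (map f xs)
    Increasing-map []           = []
    Increasing-map (x<xs ∷ inc) = map-< x<xs ∷ Increasing-map inc
      where
      map-< : ∀ {x ys} → All (x <_) ys → All (f x <_) (map f ys)
      map-< []           = []
      map-< (x<y ∷ x<ys) = mono x<y ∷ map-< x<ys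

  increasing-⊆ : ∀ {xs ys} → Increasing xs → Increasing ys → (∀ {z} → z ∈ xs → z ∈ ys) → xs ⊆ ys
  increasing-⊆ {[]}     {ys}     _             _             _     = Sublist.minimum ys
  increasing-⊆ {x ∷ xs} {[]}     _             _             xs⊆ys with () ← xs⊆ys (here refl)
  increasing-⊆ {x ∷ xs} {y ∷ ys} (x<xs ∷ incx) (y<ys ∷ incy) xs⊆ys with xs⊆ys (here refl)
  ... | here refl = refl ∷ increasing-⊆ incx incy (λ z∈ → tail-∈ (xs⊆ys (there z∈)) (<⇒≢ (All.lookup x<xs z∈)))
    where
    tail-∈ : ∀ {z} → z ∈ x ∷ ys → x ≢ z → z ∈ ys
    tail-∈ (here z≡x) x≢z = contradiction (sym z≡x) x≢z
    tail-∈ (there z∈) _   = z∈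
  ... | there x∈ys = y ∷ʳ increasing-⊆ (x<xs ∷ incx) incy (λ z∈ → tail-∈ z∈ (xs⊆ys z∈))
    where
    y<x = All.lookup y<ys x∈ys
    tail-∈ : ∀ {z} → z ∈ x ∷ xs → z ∈ y ∷ ys → z ∈ ys
    tail-∈ (here refl) (here refl) = contradiction y<x (<-irrefl refl)
    tail-∈ (there z∈)  (here refl) = contradiction (<-trans y<x (All.lookup x<xs z∈)) (<-irrefl refl)
    tail-∈ _           (there z∈)  = z∈

  countBelow : ℕ → List ℕ → ℕ
  countBelow a xs = length (filterᵇ (_<ᵇ a) xs)

  countBelow-map : ∀ {f} → f Preserves _<_ ⟶ _<_ → ∀ a w → countBelow (f a) (map f w) ≡ countBelow a w
  countBelow-map {f} mono a w = trans (cong length (filterᵇ-map (_<ᵇ f a) f w))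
    (trans (length-map f (filterᵇ (λ x → f x <ᵇ f a) w))
           (cong length (filterᵇ-cong-local _ _ w (λ {x} _ → strictMono-<ᵇ mono x a))))

  st-map : ∀ {f} → f Preserves _<_ ⟶ _<_ → ∀ w → st (map f w) ≡ st w
  st-map mono w = trans (sym (map-∘ w)) (map-cong-local (All.tabulate λ {a} _ → cong suc (countBelow-map mono a w)))

  countBelow-same-elements : ∀ a {xs ys} → Unique xs → Unique ys → (∀ {v} → v ∈ xs → v ∈ ys) → (∀ {v} → v ∈ ys → v ∈ xs) →
    countBelow a xs ≡ countBelow a ys
  countBelow-same-elements a {xs} {ys} uxs uys xs⊆ys ys⊆xs = length-≡-if-same-elements
    (Unique-filterᵇ (_<ᵇ a) uxs) (Unique-filterᵇ (_<ᵇ a) uys) (mk⇔ (transfer xs⊆ys) (transfer ys⊆xs))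
    where
    transfer : ∀ {us vs} → (∀ {v} → v ∈ us → v ∈ vs) → ∀ {v} → v ∈ filterᵇ (_<ᵇ a) us → v ∈ filterᵇ (_<ᵇ a) vs
    transfer {us} {vs} us⊆vs v∈ with v∈us , v<a ← ∈-filterᵇ⁻ (_<ᵇ a) us v∈ = ∈-filterᵇ⁺ (_<ᵇ a) vs (us⊆vs v∈us) v<a

  sortedIn : ℕ → List ℕ → List ℕ
  sortedIn n A = filterᵇ (λ v → elemᵇ v A) (range n)

  complementIn : ℕ → List ℕ → List ℕ
  complementIn n A = filterᵇ (λ v → not (elemᵇ v A)) (range n)

  ∈-sortedIn⁻ : ∀ n A {v} → v ∈ sortedIn n A → v ∈ A
  ∈-sortedIn⁻ n A v∈ = elemᵇ⇒∈ _ A (proj₂ (∈-filterᵇ⁻ _ (range n) v∈))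

  ∈-sortedIn⁺ : ∀ n {A v} → All (InRange n) A → v ∈ A → v ∈ sortedIn n A
  ∈-sortedIn⁺ n {A} bounded v∈ = ∈-filterᵇ⁺ _ (range n) (∈-range⁺ n (All.lookup bounded v∈)) (∈⇒elemᵇ _ A v∈)

  sortedIn-increasing : ∀ n A → Increasing (sortedIn n A)
  sortedIn-increasing n A = AllPairs-resp-⊆ (filterᵇ-⊆ _ (range n)) (range-increasing n)

  length-sortedIn : ∀ n {A} → Unique A → All (InRange n) A → length (sortedIn n A) ≡ length A
  length-sortedIn n {A} uA bounded = length-≡-if-same-elements
    (Unique-filterᵇ _ (Increasing⇒Unique (range-increasing n))) uA
    (mk⇔ (∈-sortedIn⁻ n A) (∈-sortedIn⁺ n bounded))

  ∈-complementIn⁻ : ∀ n A {v} → v ∈ complementIn n A → InRange n v × ¬ v ∈ A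
  ∈-complementIn⁻ n A v∈ with v∈range , v∉ ← ∈-filterᵇ⁻ _ (range n) v∈ =
    ∈-range⁻ n v∈range , T-not⇒¬T v∉ ∘ ∈⇒elemᵇ _ A

  ∈-complementIn⁺ : ∀ n A {v} → InRange n v → ¬ v ∈ A → v ∈ complementIn n A
  ∈-complementIn⁺ n A v∈ v∉ = ∈-filterᵇ⁺ _ (range n) (∈-range⁺ n v∈) (¬T⇒T-not (v∉ ∘ elemᵇ⇒∈ _ A))

  complementIn-increasing : ∀ n A → Increasing (complementIn n A)
  complementIn-increasing n A = AllPairs-resp-⊆ (filterᵇ-⊆ _ (range n)) (range-increasing n)

  length-sortedIn+complementIn : ∀ n A → length (sortedIn n A) + length (complementIn n A) ≡ n
  length-sortedIn+complementIn n A = trans (length-filterᵇ-not (λ v → elemᵇ v A) (range n)) (length-range n)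

  IsPerm⇒∋ : ∀ {n π} → IsPerm n π → ∀ {v} → InRange n v → v ∈ π
  IsPerm⇒∋ {n} {π} perm {v} v∈ with v ∈? π
  ... | yes v∈π = v∈π
  ... | no  v∉π = ⊥-elim (nonempty (complementIn n π) complement-length (∈-complementIn⁺ n π v∈ v∉π))
    where
    open IsPerm perm
    complement-length : length (complementIn n π) ≡ 0
    complement-length = +-cancelˡ-≡ n _ 0 (begin
      n + length (complementIn n π)
        ≡⟨ cong (_+ length (complementIn n π)) (sym (trans (length-sortedIn n unique inRange) length≡)) ⟩
      length (sortedIn n π) + length (complementIn n π)
        ≡⟨ length-sortedIn+complementIn n π ⟩
      n
        ≡⟨ sym (+-identityʳ n) ⟩
      n + 0 ∎)
      where open ≡-Reasoning
    nonempty : ∀ xs → length xs ≡ 0 → ¬ v ∈ xs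
    nonempty [] _ ()

  countBelow-range : ∀ k a → 1 ≤ a → a ≤ suc k → countBelow a (range k) ≡ a ∸ 1
  countBelow-range k a 1≤a a≤1+k = trans
    (length-≡-if-same-elements (Unique-filterᵇ _ (Increasing⇒Unique (range-increasing k)))
       (Increasing⇒Unique (range-increasing (a ∸ 1))) (mk⇔ below⇒range range⇒below))
    (length-range (a ∸ 1))
    where
    below⇒range : ∀ {v} → v ∈ filterᵇ (_<ᵇ a) (range k) → v ∈ range (a ∸ 1)
    below⇒range v∈ with v∈k , v<a ← ∈-filterᵇ⁻ _ (range k) v∈ with 0<v , _ ← ∈-range⁻ k v∈k =
      ∈-range⁺ (a ∸ 1) (0<v , ≤-trans (≤-reflexive (sym (m+n∸n≡m _ 1))) (∸-monoˡ-≤ 1 (subst (_≤ a) (+-comm 1 _) (<ᵇ⇒< _ a v<a))))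
    range⇒below : ∀ {v} → v ∈ range (a ∸ 1) → v ∈ filterᵇ (_<ᵇ a) (range k)
    range⇒below v∈ with 0<v , v≤a-1 ← ∈-range⁻ (a ∸ 1) v∈ =
      ∈-filterᵇ⁺ _ (range k) (∈-range⁺ k (0<v , ≤-trans v≤a-1 (∸-monoˡ-≤ 1 a≤1+k)))
        (<⇒<ᵇ (≤-trans (s≤s v≤a-1) (≤-reflexive (trans (+-comm 1 (a ∸ 1)) (m∸n+n≡m 1≤a)))))

  st-perm : ∀ {k σ} → IsPerm k σ → st σ ≡ σ
  st-perm {k} {σ} perm = trans (map-cong-local (All.tabulate rank≡)) (map-id σ)
    where
    open IsPerm perm
    open import Data.List.Properties using (map-id)
    rank≡ : ∀ {a} → a ∈ σ → rank a σ ≡ a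
    rank≡ {a} a∈ with 1≤a , a≤k ← All.lookup inRange a∈ = begin
      suc (countBelow a σ)          ≡⟨ cong suc (countBelow-same-elements a unique (Increasing⇒Unique (range-increasing k))
                                        (∈-range⁺ k ∘ All.lookup inRange) (IsPerm⇒∋ perm ∘ ∈-range⁻ k)) ⟩
      suc (countBelow a (range k))  ≡⟨ cong suc (countBelow-range k a 1≤a (≤-trans a≤k (n≤1+n k))) ⟩
      suc (a ∸ 1)                   ≡⟨ trans (+-comm 1 (a ∸ 1)) (m∸n+n≡m 1≤a) ⟩
      a                             ∎
      where open ≡-Reasoning

  nth : List ℕ → ℕ → ℕ
  nth []       _       = 0
  nth (x ∷ xs) zero    = x
  nth (x ∷ xs) (suc r) = nth xs r

  nth-countBelow : ∀ {b a} → Increasing b → a ∈ b → countBelow a b < length b × nth b (countBelow a b) ≡ a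
  nth-countBelow {x ∷ xs} {a} (a<xs ∷ inc) (here refl)
    rewrite ≮⇒<ᵇ≡false (<-irrefl {a} refl)
          | filterᵇ-none (_<ᵇ a) xs (λ y∈ y<a → <-asym (<ᵇ⇒< _ a y<a) (All.lookup a<xs y∈))
    = s≤s z≤n , refl
  nth-countBelow {x ∷ xs} {a} (x<xs ∷ inc) (there a∈) rewrite <⇒<ᵇ≡true (All.lookup x<xs a∈)
    with lt , eq ← nth-countBelow inc a∈ = s≤s lt , eq

  subseqs⇒⊆ : ∀ {w} xs → w ∈ subseqs xs → w ⊆ xs
  subseqs⇒⊆ []       (here refl) = []
  subseqs⇒⊆ (x ∷ xs) w∈ with ∈-++⁻ (map (x ∷_) (subseqs xs)) w∈
  ... | inj₂ w∈′ = x ∷ʳ subseqs⇒⊆ xs w∈′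
  ... | inj₁ w∈′ with w′ , w′∈ , refl ← ∈-map⁻ _ w∈′ = refl ∷ subseqs⇒⊆ xs w′∈

  ⊆⇒subseqs : ∀ {w xs : List ℕ} → w ⊆ xs → w ∈ subseqs xs
  ⊆⇒subseqs []                      = here refl
  ⊆⇒subseqs {xs = x ∷ xs} (x ∷ʳ w⊆) = ∈-++⁺ʳ (map (x ∷_) (subseqs xs)) (⊆⇒subseqs w⊆)
  ⊆⇒subseqs (refl ∷ w⊆)             = ∈-++⁺ˡ (∈-map⁺ _ (⊆⇒subseqs w⊆))

  containsᵇ-mono : ∀ Π {f} → f Preserves _<_ ⟶ _<_ → ∀ {π π′} → map f π ⊆ π′ →
    T (containsᵇ Π π) → T (containsᵇ Π π′)
  containsᵇ-mono Π {f} mono {π} {π′} fπ⊆π′ c with w , w∈ , σ≤w ← find (any⁻ (Π ∘ st) (subseqs π) c) =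
    any⁺ (Π ∘ st) (lose (⊆⇒subseqs (⊆-trans (map⁺ f (subseqs⇒⊆ π w∈)) fπ⊆π′)) (subst (T ∘ Π) (sym (st-map mono w)) σ≤w))

  descent : ℕ → ℕ → ℕ → ℕ
  descent i x y = if y <ᵇ x then i else 0

  majFrom-map : ∀ {f} → f Preserves _<_ ⟶ _<_ → ∀ i w → majFrom i (map f w) ≡ majFrom i w
  majFrom-map mono i []           = refl
  majFrom-map mono i (x ∷ [])     = refl
  majFrom-map mono i (x ∷ y ∷ zs) =
    cong₂ _+_ (cong (λ b → if b then i else 0) (strictMono-<ᵇ mono y x)) (majFrom-map mono (suc i) (y ∷ zs))

  majFrom-increasing : ∀ i {t} → Increasing t → majFrom i t ≡ 0
  majFrom-increasing i {[]}         _                = refl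
  majFrom-increasing i {x ∷ []}     _                = refl
  majFrom-increasing i {x ∷ y ∷ zs} ((x<y ∷ _) ∷ inc)
    rewrite ≮⇒<ᵇ≡false (<⇒≯ x<y) = majFrom-increasing (suc i) inc

  last : ℕ → List ℕ → ℕ
  last a []       = a
  last a (b ∷ bs) = last b bs

  last-map : ∀ (f : ℕ → ℕ) a as → last (f a) (map f as) ≡ f (last a as)
  last-map f a []       = refl
  last-map f a (b ∷ bs) = last-map f b bs

  majFrom-++ : ∀ i a as y ys → majFrom i ((a ∷ as) ++ y ∷ ys) ≡
    majFrom i (a ∷ as) + descent (i + length as) (last a as) y + majFrom (i + suc (length as)) (y ∷ ys)
  majFrom-++ i a []       y ys =
    cong₂ _+_ (cong (λ j → descent j a y) (sym (+-identityʳ i))) (cong (λ j → majFrom j (y ∷ ys)) (+-comm 1 i))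
  majFrom-++ i a (b ∷ bs) y ys = begin
    d + majFrom (suc i) ((b ∷ bs) ++ y ∷ ys)
      ≡⟨ cong (d +_) (majFrom-++ (suc i) b bs y ys) ⟩
    d + (majFrom (suc i) (b ∷ bs) + descent (suc i + length bs) l y + majFrom (suc i + suc (length bs)) (y ∷ ys))
      ≡⟨ cong (λ j → d + (majFrom (suc i) (b ∷ bs) + descent j l y + majFrom j′ (y ∷ ys))) (sym (+-suc i (length bs))) ⟩
    d + (majFrom (suc i) (b ∷ bs) + descent (i + suc (length bs)) l y + majFrom j′ (y ∷ ys))
      ≡⟨ reassoc d (majFrom (suc i) (b ∷ bs)) _ _ ⟩
    d + majFrom (suc i) (b ∷ bs) + descent (i + suc (length bs)) l y + majFrom j′ (y ∷ ys)
      ≡⟨ cong (λ j → d + majFrom (suc i) (b ∷ bs) + descent (i + suc (length bs)) l y + majFrom j (y ∷ ys)) (sym (+-suc i _)) ⟩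
    d + majFrom (suc i) (b ∷ bs) + descent (i + suc (length bs)) l y + majFrom (i + suc (suc (length bs))) (y ∷ ys) ∎
    where
    open ≡-Reasoning
    d = descent i a b
    l = last b bs
    j′ = suc i + suc (length bs)
    reassoc : ∀ p q r s → p + (q + r + s) ≡ p + q + r + s
    reassoc p q r s = trans (sym (+-assoc p (q + r) s)) (cong (_+ s) (sym (+-assoc p q r)))

  majFrom-++-≥ : ∀ i xs ys → majFrom (i + length xs) ys ≤ majFrom i (xs ++ ys)
  majFrom-++-≥ i []            ys       = ≤-reflexive (cong (λ j → majFrom j ys) (+-identityʳ i))
  majFrom-++-≥ i (x ∷ [])      []       = z≤n
  majFrom-++-≥ i (x ∷ [])      (y ∷ ys) = ≤-trans (≤-reflexive (cong (λ j → majFrom j (y ∷ ys)) (+-comm i 1))) (m≤n+m _ _)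
  majFrom-++-≥ i (x ∷ x′ ∷ xs) ys       = ≤-trans (≤-reflexive (cong (λ j → majFrom j ys) (+-suc i (suc (length xs)))))
    (≤-trans (majFrom-++-≥ (suc i) (x′ ∷ xs) ys) (m≤n+m _ _))

  -- A descent at position ≥ j contributes at least j.
  majFrom<⇒increasing : ∀ j ys → majFrom j ys < j → Unique ys → Increasing ys
  majFrom<⇒increasing j []           _  _              = []
  majFrom<⇒increasing j (y ∷ [])     _  _              = [] ∷ []
  majFrom<⇒increasing j (y ∷ y′ ∷ zs) lt (y≢ ∷ uniq) with y′ <ᵇ y in eq
  ... | true  = contradiction (m≤m+n j _) (<⇒≱ lt)
  ... | false = (y<y′ ∷ All.map (<-trans y<y′) y′<zs) ∷ rest
    where
    rest = majFrom<⇒increasing (suc j) (y′ ∷ zs) (≤-trans lt (n≤1+n j)) uniq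
    y′<zs : All (y′ <_) zs
    y′<zs = AllPairs.head rest
    y<y′ : y < y′
    y<y′ = ≤∧≢⇒< (≮⇒≥ (λ y′<y → subst T eq (<⇒<ᵇ y′<y))) (All.head y≢)

  majFrom-++-increasing : ∀ a as {y ys} → Increasing (y ∷ ys) →
    majFrom 1 ((a ∷ as) ++ y ∷ ys) ≡ majFrom 1 (a ∷ as) + descent (suc (length as)) (last a as) y
  majFrom-++-increasing a as {y} {ys} inc = trans (majFrom-++ 1 a as y ys)
    (trans (cong (majFrom 1 (a ∷ as) + descent (suc (length as)) (last a as) y +_) (majFrom-increasing _ inc)) (+-identityʳ _))

  -- A descent at the junction would alone contribute length as + 1.
  majFrom-++-≡-length : ∀ a as {y ys} → Increasing (y ∷ ys) → majFrom 1 ((a ∷ as) ++ y ∷ ys) ≡ length as →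
    majFrom 1 (a ∷ as) ≡ length as × ¬ y < last a as
  majFrom-++-≡-length a as {y} inc maj≡ rewrite majFrom-++-increasing a as inc with y <ᵇ last a as in eq
  ... | true  = contradiction (≤-trans (m≤n+m _ _) (≤-reflexive maj≡)) (n≮n (length as))
  ... | false = trans (sym (+-identityʳ _)) maj≡ , λ y<l → subst T eq (<⇒<ᵇ y<l)

  majFrom-++-ascent : ∀ a as {y ys} → Increasing (y ∷ ys) → ¬ y < last a as →
    majFrom 1 ((a ∷ as) ++ y ∷ ys) ≡ majFrom 1 (a ∷ as)
  majFrom-++-ascent a as {y} inc y≮l rewrite majFrom-++-increasing a as inc | ≮⇒<ᵇ≡false y≮l = +-identityʳ _

  maj-embedding : ∀ {f} → f Preserves _<_ ⟶ _<_ → ∀ a as {t t′} → Increasing t → Increasing t′ → map f t ⊆ t′ →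
    majFrom 1 (map f (a ∷ as) ++ t′) ≡ length as → majFrom 1 ((a ∷ as) ++ t) ≡ length as
  maj-embedding {f} mono a as {t} {t′} = embed t t′
    where
    fas≡ : length (map f as) ≡ length as
    fas≡ = length-map f as

    unmap : majFrom 1 (map f (a ∷ as)) ≡ length (map f as) → majFrom 1 (a ∷ as) ≡ length as
    unmap e = trans (sym (majFrom-map mono 1 (a ∷ as))) (trans e fas≡)

    drop-[] : ∀ xs {n} → majFrom 1 xs ≡ n → majFrom 1 (xs ++ []) ≡ n
    drop-[] xs = trans (cong (majFrom 1) (++-identityʳ xs))

    embed : ∀ t t′ → Increasing t → Increasing t′ → map f t ⊆ t′ →
      majFrom 1 (map f (a ∷ as) ++ t′) ≡ length as → majFrom 1 ((a ∷ as) ++ t) ≡ length as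
    embed []       []         _   _    _   maj≡ =
      drop-[] (a ∷ as) (unmap (trans (sym (cong (majFrom 1) (++-identityʳ (map f (a ∷ as))))) (trans maj≡ (sym fas≡))))
    embed []       (y′ ∷ ys′) _   inc′ _   maj≡ =
      drop-[] (a ∷ as) (unmap (proj₁ (majFrom-++-≡-length (f a) (map f as) inc′ (trans maj≡ (sym fas≡)))))
    embed (y ∷ ys) (y′ ∷ ys′) inc inc′ fy∷⊆ maj≡ = trans (majFrom-++-ascent a as inc y≮l) (unmap fA≡)
      where
      junction = majFrom-++-≡-length (f a) (map f as) inc′ (trans maj≡ (sym fas≡))
      fA≡ = proj₁ junction
      y′≤fy : y′ ≤ f y
      y′≤fy with Sublist.lookup fy∷⊆ (here refl)
      ... | here fy≡y′ = ≤-reflexive (sym fy≡y′)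
      ... | there fy∈  = <⇒≤ (All.lookup (AllPairs.head inc′) fy∈)
      y≮l : ¬ y < last a as
      y≮l y<l = proj₂ junction (≤-<-trans y′≤fy (subst (f y <_) (sym (last-map f a as)) (mono y<l)))

module Encoding where

  open ListFacts
  open Enumerations
  open Standardisation
  open Counting using (incrementAt; DownwardClosed)
  open import Data.Bool.Base using (Bool; true; false; T; _∧_; if_then_else_)
  open import Data.Bool.Properties using (T-∧)
  open import Data.Nat.Base using (ℕ; zero; suc; _+_; _≤_; _<_; _≤ᵇ_; _<ᵇ_; _≡ᵇ_; z≤n; s≤s)
  open import Data.Nat.Properties
  open import Data.Nat.ListAction using (sum)
  open import Data.List.Base using (List; []; _∷_; _++_; map; length; take)
  open import Data.List.Properties using (length-map; length-++; map-∘; map-cong; map-++; ∷-injective)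
  open import Data.List.Membership.Propositional using (_∈_)
  open import Data.List.Membership.Propositional.Properties using (∈-++⁻; ∈-map⁻)
  open import Data.List.Relation.Unary.Any using (here; there)
  open import Data.List.Relation.Unary.All as All using (All; []; _∷_)
  open import Data.List.Relation.Unary.Unique.Propositional using (Unique)
  import Data.List.Relation.Unary.Unique.Propositional.Properties as Unique
  open import Data.List.Relation.Binary.Sublist.Propositional using (_⊆_; ⊆-refl)
  open import Data.List.Relation.Binary.Sublist.Propositional.Properties using (++⁺)
  open import Data.Product using (_×_; _,_; proj₁; proj₂)
  open import Data.Sum using (inj₁; inj₂)
  open import Function using (_∘_; Equivalence)
  open import Relation.Binary.Core using (_Preserves_⟶_)
  open import Relation.Nullary using (yes; no; contradiction)
  open import Relation.Nullary.Reflects using (ofʸ; ofⁿ)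
  open import Relation.Binary.PropositionalEquality
    using (_≡_; refl; sym; trans; cong; cong₂; subst; subst₂; module ≡-Reasoning)

  partialSum : ℕ → List ℕ → ℕ
  partialSum r g = sum (take r g)

  -- With gaps g = g₀ ∷ g₁ ∷ ⋯ between consecutive values, the r-th smallest value is r + g₀ + ⋯ + g_{r-1}.
  value : List ℕ → ℕ → ℕ
  value g r = r + partialSum r g

  assemble : List ℕ → List ℕ → List ℕ
  assemble σ g = map (value g) σ ++ complementIn (length σ + sum g) (map (value g) σ)

  admissible : PatternSet → ℕ → List ℕ → List ℕ → Bool
  admissible Π m σ g = avoidsᵇ Π (assemble σ g) ∧ (maj (assemble σ g) ≡ᵇ m)

  partialSum-mono : ∀ g {r r′} → r ≤ r′ → partialSum r g ≤ partialSum r′ g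
  partialSum-mono g       {zero}            _         = z≤n
  partialSum-mono []      {suc r} {suc r′} _         = z≤n
  partialSum-mono (x ∷ g) {suc r} {suc r′} (s≤s r≤r′) = +-monoʳ-≤ x (partialSum-mono g r≤r′)

  partialSum-≤-sum : ∀ r g → partialSum r g ≤ sum g
  partialSum-≤-sum zero    g       = z≤n
  partialSum-≤-sum (suc r) []      = z≤n
  partialSum-≤-sum (suc r) (x ∷ g) = +-monoʳ-≤ x (partialSum-≤-sum r g)

  value-strictMono : ∀ g → value g Preserves _<_ ⟶ _<_
  value-strictMono g r<r′ = +-mono-<-≤ r<r′ (partialSum-mono g (<⇒≤ r<r′))

  IsPerm-assemble : ∀ {k σ} g → IsPerm k σ → IsPerm (k + sum g) (assemble σ g)
  IsPerm-assemble {k} {σ} g perm with refl ← IsPerm.length≡ perm = record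
    { length≡ = trans (length-++ A) (trans (cong (_+ length (complementIn n A)) (sym (length-sortedIn n uA bounded)))
                                           (length-sortedIn+complementIn n A))
    ; inRange = All.tabulate inRange′
    ; unique  = Unique.++⁺ uA (Unique-filterᵇ _ (Increasing⇒Unique (range-increasing n)))
                  (λ (v∈A , v∈c) → proj₂ (∈-complementIn⁻ n A v∈c) v∈A)
    }
    where
    open IsPerm perm
    n = length σ + sum g
    A = map (value g) σ
    bounded : All (InRange n) A
    bounded = All.tabulate λ v∈ → let r , r∈ , v≡ = ∈-map⁻ _ v∈ ; 0<r , r≤k = All.lookup inRange r∈ in
      subst (InRange n) (sym v≡)
        (≤-trans 0<r (m≤m+n _ _) , +-mono-≤ r≤k (partialSum-≤-sum r g))
    uA : Unique A
    uA = Unique-map-local (value g) σ unique (λ _ _ → strictMono⇒injective (value-strictMono g))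
    inRange′ : ∀ {v} → v ∈ assemble σ g → InRange n v
    inRange′ {v} v∈ with ∈-++⁻ A v∈
    ... | inj₁ v∈A = All.lookup bounded v∈A
    ... | inj₂ v∈c = proj₁ (∈-complementIn⁻ n A v∈c)

  ++-injectiveˡ : ∀ {A : Set} (xs xs′ : List A) {ys ys′} → length xs ≡ length xs′ → xs ++ ys ≡ xs′ ++ ys′ → xs ≡ xs′
  ++-injectiveˡ []       []         _   _ = refl
  ++-injectiveˡ (x ∷ xs) (x′ ∷ xs′) len e with x≡x′ , e′ ← ∷-injective e =
    cong₂ _∷_ x≡x′ (++-injectiveˡ xs xs′ (suc-injective len) e′)

  map-≡⇒≗-local : ∀ (f f′ : ℕ → ℕ) xs → map f xs ≡ map f′ xs → ∀ {x} → x ∈ xs → f x ≡ f′ x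
  map-≡⇒≗-local f f′ (y ∷ ys) e (here refl) = proj₁ (∷-injective e)
  map-≡⇒≗-local f f′ (y ∷ ys) e (there x∈)  = map-≡⇒≗-local f f′ ys (proj₂ (∷-injective e)) x∈

  partialSums-injective : ∀ k g g′ → length g ≡ suc k → length g′ ≡ suc k →
    (∀ r → 1 ≤ r → r ≤ k → partialSum r g ≡ partialSum r g′) → sum g ≡ sum g′ → g ≡ g′
  partialSums-injective zero    (x ∷ []) (x′ ∷ [])  _   _    _   total = cong (_∷ []) (+-cancelʳ-≡ 0 x x′ total)
  partialSums-injective (suc k) (x ∷ h)  (x′ ∷ h′) len len′ ps≡ total = cong₂ _∷_ x≡x′
    (partialSums-injective k h h′ (suc-injective len) (suc-injective len′)
      (λ r 1≤r r≤k → +-cancelˡ-≡ x _ _ (trans (ps≡ (suc r) (s≤s z≤n) (s≤s r≤k)) (cong (_+ partialSum r h′) (sym x≡x′))))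
      (+-cancelˡ-≡ x _ _ (trans total (cong (_+ sum h′) (sym x≡x′)))))
    where
    x≡x′ : x ≡ x′
    x≡x′ = +-cancelʳ-≡ 0 x x′ (ps≡ 1 (s≤s z≤n) (s≤s z≤n))

  assemble-injective : ∀ {k σ σ′ g g′} → IsPerm k σ → IsPerm k σ′ → length g ≡ suc k → length g′ ≡ suc k →
    sum g ≡ sum g′ → assemble σ g ≡ assemble σ′ g′ → σ ≡ σ′ × g ≡ g′
  assemble-injective {k} {σ} {σ′} {g} {g′} perm perm′ len len′ total e = σ≡σ′ , g≡g′
    where
    firstBlock : map (value g) σ ≡ map (value g′) σ′
    firstBlock = ++-injectiveˡ _ _ (trans (length-map (value g) σ)
      (trans (IsPerm.length≡ perm) (sym (trans (length-map (value g′) σ′) (IsPerm.length≡ perm′))))) e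
    σ≡σ′ : σ ≡ σ′
    σ≡σ′ = begin
      σ                      ≡⟨ sym (st-perm perm) ⟩
      st σ                   ≡⟨ sym (st-map (value-strictMono g) σ) ⟩
      st (map (value g) σ)   ≡⟨ cong st firstBlock ⟩
      st (map (value g′) σ′) ≡⟨ st-map (value-strictMono g′) σ′ ⟩
      st σ′                  ≡⟨ st-perm perm′ ⟩
      σ′                     ∎
      where open ≡-Reasoning
    g≡g′ : g ≡ g′
    g≡g′ = partialSums-injective k g g′ len len′
      (λ r 1≤r r≤k → +-cancelˡ-≡ r _ _ (map-≡⇒≗-local (value g) (value g′) σ
         (trans firstBlock (cong (map (value g′)) (sym σ≡σ′))) (IsPerm⇒∋ perm (1≤r , r≤k))))
      total

  incrementAt-id : ∀ j g → length g ≤ j → incrementAt j g ≡ g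
  incrementAt-id j       []      _           = refl
  incrementAt-id (suc j) (x ∷ g) (s≤s g≤j)   = cong (x ∷_) (incrementAt-id j g g≤j)

  sum-incrementAt : ∀ j g → j < length g → sum (incrementAt j g) ≡ suc (sum g)
  sum-incrementAt zero    (x ∷ g) _         = refl
  sum-incrementAt (suc j) (x ∷ g) (s≤s j<g) = trans (cong (x +_) (sum-incrementAt j g j<g)) (+-suc x (sum g))

  partialSum-incrementAt : ∀ j g → j < length g → ∀ r → partialSum r (incrementAt j g) ≡ partialSum r g + (if j <ᵇ r then 1 else 0)
  partialSum-incrementAt zero    (x ∷ h) _         zero    = refl
  partialSum-incrementAt zero    (x ∷ h) _         (suc r) = +-comm 1 (x + partialSum r h)
  partialSum-incrementAt (suc j) (x ∷ h) _         zero    = refl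
  partialSum-incrementAt (suc j) (x ∷ h) (s≤s j<h) (suc r) =
    trans (cong (x +_) (partialSum-incrementAt j h j<h r)) (sym (+-assoc x (partialSum r h) _))

  skipAbove : ℕ → ℕ → ℕ
  skipAbove c v = if v ≤ᵇ c then v else suc v

  skipAbove-≤ : ∀ {c v} → v ≤ c → skipAbove c v ≡ v
  skipAbove-≤ {c} {v} v≤c with v ≤ᵇ c | ≤ᵇ-reflects-≤ v c
  ... | true  | _        = refl
  ... | false | ofⁿ v≰c = contradiction v≤c v≰c

  skipAbove-> : ∀ {c v} → c < v → skipAbove c v ≡ suc v
  skipAbove-> {c} {v} c<v with v ≤ᵇ c | ≤ᵇ-reflects-≤ v c
  ... | true  | ofʸ v≤c = contradiction v≤c (<⇒≱ c<v)
  ... | false | _       = refl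

  skipAbove-strictMono : ∀ c → skipAbove c Preserves _<_ ⟶ _<_
  skipAbove-strictMono c {x} {y} x<y with y ≤? c | x ≤? c
  ... | yes y≤c | _       rewrite skipAbove-≤ y≤c | skipAbove-≤ (≤-trans (<⇒≤ x<y) y≤c) = x<y
  ... | no  y≰c | yes x≤c rewrite skipAbove-> (≰⇒> y≰c) | skipAbove-≤ x≤c = m<n⇒m<1+n x<y
  ... | no  y≰c | no  x≰c rewrite skipAbove-> (≰⇒> y≰c) | skipAbove-> (≰⇒> x≰c) = s≤s x<y

  skipAbove-bounds : ∀ c v → v ≤ skipAbove c v × skipAbove c v ≤ suc v
  skipAbove-bounds c v with v ≤? c
  ... | yes v≤c rewrite skipAbove-≤ v≤c = ≤-refl , n≤1+n v
  ... | no  v≰c rewrite skipAbove-> (≰⇒> v≰c) = n≤1+n v , ≤-refl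

  value-incrementAt : ∀ j g → j < length g → ∀ r → value (incrementAt j g) r ≡ skipAbove (value g j) (value g r)
  value-incrementAt j g j<g r rewrite partialSum-incrementAt j g j<g r with r ≤? j
  ... | yes r≤j rewrite ≮⇒<ᵇ≡false (≤⇒≯ r≤j) | skipAbove-≤ (strictMono⇒≤ (value-strictMono g) r≤j) =
    cong (r +_) (+-identityʳ (partialSum r g))
  ... | no  r≰j rewrite <⇒<ᵇ≡true (≰⇒> r≰j) | skipAbove-> (value-strictMono g (≰⇒> r≰j)) =
    trans (cong (r +_) (+-comm (partialSum r g) 1)) (+-suc r (partialSum r g))

  module Increment {σ : List ℕ} (g : List ℕ) (j : ℕ) (j<g : j < length g) where

    f = skipAbove (value g j)
    mono = skipAbove-strictMono (value g j)

    A  = map (value g) σ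
    n  = length σ + sum g
    A′ = map (value (incrementAt j g)) σ
    n′ = length σ + sum (incrementAt j g)

    A′≡ : A′ ≡ map f A
    A′≡ = trans (map-cong (value-incrementAt j g j<g) σ) (map-∘ σ)

    n′≡ : n′ ≡ suc n
    n′≡ = trans (cong (length σ +_) (sum-incrementAt j g j<g)) (+-suc (length σ) (sum g))

    complement-embeds : map f (complementIn n A) ⊆ complementIn n′ A′
    complement-embeds = increasing-⊆ (Increasing-map mono (complementIn-increasing n A)) (complementIn-increasing n′ A′) embeds
      where
      embeds : ∀ {z} → z ∈ map f (complementIn n A) → z ∈ complementIn n′ A′
      embeds z∈ with v , v∈ , refl ← ∈-map⁻ _ z∈ with (0<v , v≤n) , v∉A ← ∈-complementIn⁻ n A v∈ =
        ∈-complementIn⁺ n′ A′ (<-≤-trans 0<v (proj₁ (skipAbove-bounds _ v)) ,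
                               subst (f v ≤_) (sym n′≡) (≤-trans (proj₂ (skipAbove-bounds _ v)) (s≤s v≤n)))
          λ fv∈A′ → let a , a∈A , fv≡fa = ∈-map⁻ _ (subst (f v ∈_) A′≡ fv∈A′) in
                    v∉A (subst (_∈ A) (sym (strictMono⇒injective mono fv≡fa)) a∈A)

    assemble-embeds : map f (assemble σ g) ⊆ assemble σ (incrementAt j g)
    assemble-embeds = subst₂ _⊆_ (sym (map-++ f A (complementIn n A))) (cong (_++ complementIn n′ A′) (sym A′≡))
      (++⁺ ⊆-refl complement-embeds)

  admissible-downwardClosed : ∀ Π m {σ} → IsPerm (suc m) σ → DownwardClosed (admissible Π m σ)
  admissible-downwardClosed Π m {σ} perm j g adm′ with length g ≤? j
  ... | yes g≤j = subst (T ∘ admissible Π m σ) (incrementAt-id j g g≤j) adm′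
  ... | no  g≰j = Equivalence.from T-∧ (avoids , ≡⇒≡ᵇ _ m (majFirstBlock σ (IsPerm.length≡ perm) maj≡))
    where
    open Increment {σ} g j (≰⇒> g≰j)
    avoids′ = proj₁ (Equivalence.to T-∧ adm′)
    maj≡ : majFrom 1 (map f A ++ complementIn n′ A′) ≡ m
    maj≡ = trans (cong (λ X → majFrom 1 (X ++ complementIn n′ A′)) (sym A′≡))
                 (≡ᵇ⇒≡ _ m (proj₂ (Equivalence.to T-∧ adm′)))

    avoids : T (avoidsᵇ Π (assemble σ g))
    avoids = ¬T⇒T-not (T-not⇒¬T avoids′ ∘ containsᵇ-mono Π mono assemble-embeds)

    majFirstBlock : ∀ τ → length τ ≡ suc m → majFrom 1 (map f (map (value g) τ) ++ complementIn n′ A′) ≡ m →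
                    majFrom 1 (map (value g) τ ++ complementIn n A) ≡ m
    majFirstBlock (s ∷ ss) len maj≡ = trans
      (maj-embedding mono (value g s) (map (value g) ss) (complementIn-increasing n A) (complementIn-increasing n′ A′)
         complement-embeds (trans maj≡ (sym ss≡)))
      ss≡
      where
      ss≡ : length (map (value g) ss) ≡ m
      ss≡ = trans (length-map (value g) ss) (suc-injective len)

module Decoding where

  open ListFacts
  open Enumerations
  open Standardisation
  open Encoding
  open import Data.Bool.Base using (true)
  open import Data.Nat.Base using (ℕ; zero; suc; _+_; _∸_; _≤_; _<_; _<ᵇ_; _⊓_; z≤n; s≤s)
  open import Data.Nat.Properties
  open import Data.Nat.Solver using (module +-*-Solver)
  open import Data.Nat.ListAction using (sum)
  open import Data.List.Base using (List; []; _∷_; _++_; map; length; take; drop)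
  open import Data.List.Properties using (length-map; map-∘; map-cong-local; length-take; take++drop≡id)
  open import Data.List.Membership.Propositional using (_∈_)
  open import Data.List.Membership.Propositional.Properties using (∈-++⁺ʳ; ∈-++⁻; ∈-map⁻)
  open import Data.List.Relation.Unary.All as All using (All; []; _∷_)
  open import Data.List.Relation.Unary.AllPairs using ([]; _∷_)
  open import Data.List.Relation.Unary.Unique.Propositional using (Unique)
  open import Data.List.Relation.Binary.Sublist.Propositional using (_⊆_; ⊆-refl; ⊆-antisym)
  open import Data.List.Relation.Binary.Sublist.Propositional.Properties using (++⁺ˡ; ++⁺ʳ)
  open import Data.Product using (Σ; _×_; _,_; proj₁; proj₂)
  open import Data.Sum using (inj₁; inj₂)
  open import Function using (_∘_)
  open import Relation.Binary.Definitions using (tri<; tri≈; tri>)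
  open import Relation.Nullary using (contradiction)
  open import Relation.Binary.PropositionalEquality
    using (_≡_; refl; sym; trans; cong; cong₂; subst; module ≡-Reasoning)

  open +-*-Solver

  -- The gaps between consecutive members of p, b, n + 1 (for b increasing within (p, n]).
  gaps : ℕ → List ℕ → ℕ → List ℕ
  gaps p []       n = (n ∸ p) ∷ []
  gaps p (x ∷ xs) n = (x ∸ suc p) ∷ gaps x xs n

  length-gaps : ∀ p b n → length (gaps p b n) ≡ suc (length b)
  length-gaps p []       n = refl
  length-gaps p (x ∷ xs) n = cong suc (length-gaps x xs n)

  sum-gaps : ∀ p b n → Increasing b → All (p <_) b → All (_≤ n) b → p ≤ n → sum (gaps p b n) + length b + p ≡ n
  sum-gaps p []       n _            _         _          p≤n =
    trans (cong (_+ p) (+-identityʳ _)) (trans (cong (_+ p) (+-identityʳ (n ∸ p))) (m∸n+n≡m p≤n))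
  sum-gaps p (x ∷ xs) n (x<xs ∷ inc) (p<x ∷ _) (x≤n ∷ ≤n) _   = begin
    (x ∸ suc p) + sum (gaps x xs n) + suc (length xs) + p ≡⟨ shuffle (x ∸ suc p) (sum (gaps x xs n)) (length xs) p ⟩
    sum (gaps x xs n) + length xs + ((x ∸ suc p) + suc p) ≡⟨ cong (sum (gaps x xs n) + length xs +_) (m∸n+n≡m p<x) ⟩
    sum (gaps x xs n) + length xs + x                     ≡⟨ sum-gaps x xs n inc x<xs ≤n x≤n ⟩
    n                                                     ∎
    where
    open ≡-Reasoning
    shuffle : ∀ d s l p → d + s + suc l + p ≡ s + l + (d + suc p)
    shuffle = solve 4 (λ d s l p → d :+ s :+ (con 1 :+ l) :+ p := s :+ l :+ (d :+ (con 1 :+ p))) refl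

  value-gaps : ∀ p b n → Increasing b → All (p <_) b → ∀ r → r < length b → value (gaps p b n) (suc r) + p ≡ nth b r
  value-gaps p (x ∷ xs) n _            (p<x ∷ _) zero    _         = trans (shuffle (x ∸ suc p) p) (m∸n+n≡m p<x)
    where
    shuffle : ∀ d p → 1 + (d + 0) + p ≡ d + suc p
    shuffle = solve 2 (λ d p → con 1 :+ (d :+ con 0) :+ p := d :+ (con 1 :+ p)) refl
  value-gaps p (x ∷ xs) n (x<xs ∷ inc) (p<x ∷ _) (suc r) (s≤s r<) = begin
    suc (suc r) + ((x ∸ suc p) + partialSum (suc r) (gaps x xs n)) + p
      ≡⟨ shuffle (x ∸ suc p) (partialSum (suc r) (gaps x xs n)) r p ⟩
    suc r + partialSum (suc r) (gaps x xs n) + ((x ∸ suc p) + suc p)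
      ≡⟨ cong (value (gaps x xs n) (suc r) +_) (m∸n+n≡m p<x) ⟩
    value (gaps x xs n) (suc r) + x
      ≡⟨ value-gaps x xs n inc x<xs r r< ⟩
    nth xs r ∎
    where
    open ≡-Reasoning
    shuffle : ∀ d s r p → 2 + r + (d + s) + p ≡ 1 + r + s + (d + suc p)
    shuffle = solve 4 (λ d s r p → con 2 :+ r :+ (d :+ s) :+ p := con 1 :+ r :+ s :+ (d :+ (con 1 :+ p))) refl

  countBelow-<-length : ∀ {a A} → a ∈ A → countBelow a A < length A
  countBelow-<-length {a} {A} a∈ = subst (countBelow a A <_) (cong length (filterᵇ-all (λ _ → true) A (λ _ → _)))
    (length-filterᵇ-mono-< (_<ᵇ a) (λ _ → true) A (λ _ _ → _) a∈ (λ a<a → <-irrefl refl (<ᵇ⇒< a a a<a)) _)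

  countBelow-strictMono : ∀ {A x y} → x ∈ A → x < y → countBelow x A < countBelow y A
  countBelow-strictMono {A} {x} {y} x∈ x<y = length-filterᵇ-mono-< (_<ᵇ x) (_<ᵇ y) A
    (λ {z} _ z<x → <⇒<ᵇ (<-trans (<ᵇ⇒< z x z<x) x<y)) x∈ (λ x<x → <-irrefl refl (<ᵇ⇒< x x x<x)) (<⇒<ᵇ x<y)

  IsPerm-st : ∀ {A} → Unique A → IsPerm (length A) (st A)
  IsPerm-st {A} uA = record
    { length≡ = length-map (λ a → rank a A) A
    ; inRange = All.tabulate λ v∈ → let a , a∈ , v≡ = ∈-map⁻ _ v∈ in
        subst (InRange (length A)) (sym v≡) (s≤s z≤n , countBelow-<-length a∈)
    ; unique  = Unique-map-local (λ a → rank a A) A uA rank-injective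
    }
    where
    rank-injective : ∀ {x y} → x ∈ A → y ∈ A → rank x A ≡ rank y A → x ≡ y
    rank-injective {x} {y} x∈ y∈ rank≡ with <-cmp x y
    ... | tri< x<y _ _ = contradiction (suc-injective rank≡) (<⇒≢ (countBelow-strictMono x∈ x<y))
    ... | tri≈ _ x≡y _ = x≡y
    ... | tri> _ _ y<x = contradiction (sym (suc-injective rank≡)) (<⇒≢ (countBelow-strictMono y∈ y<x))

  map-value-gaps-st : ∀ n {A} → Unique A → All (InRange n) A → map (value (gaps 0 (sortedIn n A) n)) (st A) ≡ A
  map-value-gaps-st n {A} uA bounded = trans (sym (map-∘ A)) (trans (map-cong-local (All.tabulate value≡)) (map-id A))
    where
    open import Data.List.Properties using (map-id)
    b = sortedIn n A
    inc = sortedIn-increasing n A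
    value≡ : ∀ {a} → a ∈ A → value (gaps 0 b n) (rank a A) ≡ a
    value≡ {a} a∈ with bound , nth≡ ← nth-countBelow inc (∈-sortedIn⁺ n bounded a∈) = begin
      value (gaps 0 b n) (suc (countBelow a A))      ≡⟨ cong (value (gaps 0 b n) ∘ suc) (countBelow-same-elements a uA
                                                        (Unique-filterᵇ _ (Increasing⇒Unique (range-increasing n)))
                                                        (∈-sortedIn⁺ n bounded) (∈-sortedIn⁻ n A)) ⟩
      value (gaps 0 b n) (suc (countBelow a b))
        ≡⟨ sym (+-identityʳ _) ⟩
      value (gaps 0 b n) (suc (countBelow a b)) + 0
        ≡⟨ value-gaps 0 b n inc (All.tabulate (proj₁ ∘ ∈-range⁻ n ∘ proj₁ ∘ ∈-filterᵇ⁻ _ (range n))) _ bound ⟩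
      nth b (countBelow a b)
        ≡⟨ nth≡ ⟩
      a ∎
      where open ≡-Reasoning

  decompose : ∀ m N {π} → IsPerm (suc m + N) π → maj π ≡ m →
    Σ (List ℕ) λ σ → Σ (List ℕ) λ g → IsPerm (suc m) σ × IsComposition (suc (suc m)) N g × assemble σ g ≡ π
  decompose m N {π} perm maj≡ = st A , g , σ-perm , (length-g , sum-g) , assembled
    where
    open IsPerm perm
    k = suc m
    n = k + N
    A = take k π
    t = drop k π
    π≡ : A ++ t ≡ π
    π≡ = take++drop≡id k π
    length-A : length A ≡ k
    length-A = trans (length-take k π) (trans (cong (k ⊓_) length≡) (m≤n⇒m⊓n≡m (m≤m+n k N)))
    unique′ : Unique (A ++ t)
    unique′ = subst Unique (sym π≡) unique
    inRange′ : All (InRange n) (A ++ t)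
    inRange′ = subst (All (InRange n)) (sym π≡) inRange
    A⊆ : A ⊆ A ++ t
    A⊆ = ++⁺ʳ t ⊆-refl
    t⊆ : t ⊆ A ++ t
    t⊆ = ++⁺ˡ A ⊆-refl
    uA = AllPairs-resp-⊆ A⊆ unique′
    bA = All-resp-⊆ A⊆ inRange′

    t-increasing : Increasing t
    t-increasing = majFrom<⇒increasing (suc k) t (begin-strict
      majFrom (suc k) t        ≡⟨ cong (λ l → majFrom (suc l) t) (sym length-A) ⟩
      majFrom (1 + length A) t ≤⟨ majFrom-++-≥ 1 A t ⟩
      majFrom 1 (A ++ t)       ≡⟨ cong maj π≡ ⟩
      maj π                    ≡⟨ maj≡ ⟩
      m                        <⟨ n<1+n m ⟩
      suc m                    <⟨ n<1+n k ⟩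
      suc k                    ∎) (AllPairs-resp-⊆ t⊆ unique′)
      where open ≤-Reasoning

    b = sortedIn n A
    g = gaps 0 b n
    length-b : length b ≡ k
    length-b = trans (length-sortedIn n uA bA) length-A

    σ-perm : IsPerm k (st A)
    σ-perm = subst (λ l → IsPerm l (st A)) length-A (IsPerm-st uA)

    length-g : length g ≡ suc k
    length-g = trans (length-gaps 0 b n) (cong suc length-b)

    sum-g : sum g ≡ N
    sum-g = +-cancelʳ-≡ k (sum g) N (begin
      sum g + k            ≡⟨ cong (sum g +_) (sym length-b) ⟩
      sum g + length b     ≡⟨ sym (+-identityʳ _) ⟩
      sum g + length b + 0 ≡⟨ sum-gaps 0 b n (sortedIn-increasing n A) b-positive b-bounded z≤n ⟩
      k + N                ≡⟨ +-comm k N ⟩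
      N + k                ∎)
      where
      open ≡-Reasoning
      b-positive = All.tabulate (proj₁ ∘ ∈-range⁻ n ∘ proj₁ ∘ ∈-filterᵇ⁻ _ (range n))
      b-bounded  = All.tabulate (proj₂ ∘ ∈-range⁻ n ∘ proj₁ ∘ ∈-filterᵇ⁻ _ (range n))

    complement≡t : complementIn n A ≡ t
    complement≡t = ⊆-antisym (increasing-⊆ (complementIn-increasing n A) t-increasing complement⇒t)
                             (increasing-⊆ t-increasing (complementIn-increasing n A) t⇒complement)
      where
      complement⇒t : ∀ {v} → v ∈ complementIn n A → v ∈ t
      complement⇒t v∈ with v∈n , v∉A ← ∈-complementIn⁻ n A v∈
        with ∈-++⁻ A (subst (_ ∈_) (sym π≡) (IsPerm⇒∋ perm v∈n))
      ... | inj₁ v∈A = contradiction v∈A v∉A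
      ... | inj₂ v∈t = v∈t
      t⇒complement : ∀ {v} → v ∈ t → v ∈ complementIn n A
      t⇒complement v∈ = ∈-complementIn⁺ n A (All.lookup inRange′ (∈-++⁺ʳ A v∈)) (λ v∈A → Unique-++-disjoint unique′ v∈A v∈)

    assembled : assemble (st A) g ≡ π
    assembled = begin
      map (value g) (st A) ++ complementIn (length (st A) + sum g) (map (value g) (st A))
        ≡⟨ cong₂ (λ X l → X ++ complementIn l X) (map-value-gaps-st n uA bA) (cong₂ _+_ (IsPerm.length≡ σ-perm) sum-g) ⟩
      A ++ complementIn n A  ≡⟨ cong (A ++_) complement≡t ⟩
      A ++ t                 ≡⟨ π≡ ⟩
      π                      ∎
      where open ≡-Reasoning

open ListFacts
open Enumerations
open Newton
open Polynomials
open Counting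
open Encoding
open Decoding
open import Level using (0ℓ)
open import Axiom.ExcludedMiddle using (ExcludedMiddle)
open import Data.Bool.Base using (Bool; _∧_)
open import Data.Bool.Properties using (T-∧)
open import Data.Nat.Base using (ℕ; suc; _+_; _∸_; _≤_; _≥_; _≡ᵇ_)
open import Data.Nat.Properties using (m+[n∸m]≡n; m+n∸m≡n; ≡ᵇ⇒≡)
open import Data.Nat.ListAction using (sum)
open import Data.List.Base using (List; map; concatMap; length)
open import Data.List.Properties using (length-map; map-cong)
open import Data.List.Membership.Propositional using (_∈_; find; lose)
open import Data.List.Membership.Propositional.Properties using (∈-map⁺; ∈-map⁻; ∈-concatMap⁺; ∈-concatMap⁻)
open import Data.List.Relation.Unary.Unique.Propositional using (Unique)
import Data.List.Relation.Unary.Unique.Propositional.Properties as Unique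
open import Data.Product using (Σ; _×_; _,_; proj₁; proj₂; uncurry)
open import Data.Product.Properties using (,-injectiveˡ; ,-injectiveʳ)
open import Function using (mk⇔; Equivalence)
open import Relation.Binary.PropositionalEquality
  using (_≡_; refl; sym; trans; cong; subst)

module PermutationCount (Π : PatternSet) (m : ℕ) where

  admissibleCount : ℕ → ℕ
  admissibleCount N = sum (map (λ σ → count (admissible Π m σ) (suc (suc m)) N) (S (suc m)))

  module _ (N : ℕ) where

    k = suc m

    counted : List ℕ → Bool
    counted π = avoidsᵇ Π π ∧ (maj π ≡ᵇ m)

    codes : List (List ℕ × List ℕ)
    codes = concatMap (λ σ → map (σ ,_) (compositions (suc k) N)) (S k)

    admissibleCode : List ℕ × List ℕ → Bool
    admissibleCode = uncurry (admissible Π m)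

    ∈-codes⁻ : ∀ {σ g} → (σ , g) ∈ codes → IsPerm k σ × IsComposition (suc k) N g
    ∈-codes⁻ c∈ with σ , σ∈ , c∈′ ← find (∈-concatMap⁻ _ {xs = S k} c∈) with g , g∈ , refl ← ∈-map⁻ _ c∈′ =
      ∈-S⁻ k σ∈ , ∈-compositions⁻ (suc k) N g∈

    ∈-codes⁺ : ∀ {σ g} → IsPerm k σ → IsComposition (suc k) N g → (σ , g) ∈ codes
    ∈-codes⁺ σ-perm g-comp = ∈-concatMap⁺ _ (lose (∈-S⁺ k σ-perm) (∈-map⁺ _ (∈-compositions⁺ (suc k) N g-comp)))

    Unique-codes : Unique codes
    Unique-codes = Unique-concatMap _ (S k) (Unique-S k)
      (λ _ → Unique.map⁺ ,-injectiveʳ (Unique-compositions (suc k) N))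
      (λ _ _ c∈ c∈′ → firsts-agree c∈ c∈′)
      where
      firsts-agree : ∀ {σ σ′ c} → c ∈ map (σ ,_) (compositions (suc k) N) → c ∈ map (σ′ ,_) (compositions (suc k) N) → σ ≡ σ′
      firsts-agree c∈ c∈′ with _ , _ , refl ← ∈-map⁻ _ c∈ | _ , _ , c≡ ← ∈-map⁻ _ c∈′ = ,-injectiveˡ c≡

    count-admissible-codes : length (filterᵇ admissibleCode codes) ≡ sum (map (λ σ → count (admissible Π m σ) (suc k) N) (S k))
    count-admissible-codes = trans (length-filterᵇ-concatMap admissibleCode _ (S k))
      (cong sum (map-cong (λ σ → trans (cong length (filterᵇ-map admissibleCode (σ ,_) (compositions (suc k) N)))
                                       (length-map (σ ,_) (filterᵇ (admissible Π m σ) (compositions (suc k) N)))) (S k)))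

    assemble-admissible-codes : length (filterᵇ admissibleCode codes) ≡ M (k + N) m Π
    assemble-admissible-codes = trans (sym (length-map (uncurry assemble) (filterᵇ admissibleCode codes)))
      (length-≡-if-same-elements
        (Unique-map-local (uncurry assemble) _ (Unique-filterᵇ admissibleCode Unique-codes) injective)
        (Unique-filterᵇ counted (Unique-S (k + N)))
        (mk⇔ sound complete))
      where
      injective : ∀ {c c′} → c ∈ filterᵇ admissibleCode codes → c′ ∈ filterᵇ admissibleCode codes →
                  uncurry assemble c ≡ uncurry assemble c′ → c ≡ c′
      injective {σ , g} {σ′ , g′} c∈ c′∈ assemble≡
        with σ-perm , g-len , g-sum ← ∈-codes⁻ (proj₁ (∈-filterᵇ⁻ admissibleCode codes c∈))
           | σ′-perm , g′-len , g′-sum ← ∈-codes⁻ (proj₁ (∈-filterᵇ⁻ admissibleCode codes c′∈))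
        with refl , refl ← assemble-injective σ-perm σ′-perm g-len g′-len (trans g-sum (sym g′-sum)) assemble≡ = refl

      sound : ∀ {π} → π ∈ map (uncurry assemble) (filterᵇ admissibleCode codes) → π ∈ filterᵇ counted (S (k + N))
      sound π∈ with (σ , g) , c∈ , refl ← ∈-map⁻ _ π∈ with c∈codes , adm ← ∈-filterᵇ⁻ admissibleCode codes c∈
        with σ-perm , g-len , refl ← ∈-codes⁻ c∈codes =
        ∈-filterᵇ⁺ counted (S (k + N)) (∈-S⁺ (k + sum g) (IsPerm-assemble g σ-perm)) adm

      complete : ∀ {π} → π ∈ filterᵇ counted (S (k + N)) → π ∈ map (uncurry assemble) (filterᵇ admissibleCode codes)
      complete π∈ with π∈S , π-counted ← ∈-filterᵇ⁻ counted (S (k + N)) π∈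
        with σ , g , σ-perm , g-comp , refl ←
               decompose m N (∈-S⁻ (k + N) π∈S) (≡ᵇ⇒≡ _ m (proj₂ (Equivalence.to T-∧ π-counted))) =
        ∈-map⁺ (uncurry assemble) (∈-filterᵇ⁺ admissibleCode codes (∈-codes⁺ σ-perm g-comp) π-counted)

    M-via-codes : M (k + N) m Π ≡ admissibleCount N
    M-via-codes = trans (sym assemble-admissible-codes) count-admissible-codes

  M≡admissibleCount : ∀ n → suc m ≤ n → M n m Π ≡ admissibleCount (n ∸ suc m)
  M≡admissibleCount n m<n = subst (λ n → M n m Π ≡ admissibleCount (n ∸ suc m)) (m+[n∸m]≡n m<n)
    (trans (M-via-codes (n ∸ suc m)) (cong admissibleCount (sym (m+n∸m≡n (suc m) (n ∸ suc m)))))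

  admissibleCount-eventuallyNewton : ExcludedMiddle 0ℓ → EventuallyNewton admissibleCount
  admissibleCount-eventuallyNewton lem = EventuallyNewton-sum (λ σ → count (admissible Π m σ) (suc (suc m))) (S (suc m))
    (λ σ∈ → count-eventuallyNewton lem (suc (suc m)) _ (admissible-downwardClosed Π m (∈-S⁻ (suc m) σ∈)))

mainTheorem5 : ExcludedMiddle 0ℓ → (Π : PatternSet) (m : ℕ) →
    Σ Poly (λ P → Σ ℕ (λ n₀ → (n : ℕ) → n ≥ n₀ → ℕ→ℚ (M n m Π) ≡ eval P (ℕ→ℚ n)))
mainTheorem5 lem Π m = EventuallyNewton⇒polynomial {λ n → M n m Π}
  (EventuallyNewton-eventually {λ n → M n m Π} {λ n → admissibleCount (n ∸ suc m)} (suc m) M≡admissibleCount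
    (EventuallyNewton-∘∸ {admissibleCount} (suc m) (admissibleCount-eventuallyNewton lem)))
  where open PermutationCount Π m
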